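{- Let $G$ be a finite abstract simplicial complex, $K\subseteq G$ a subcomplex, $U=G\setminus K$, and $m\ge 1$. Let $b(G)$ be the Betti vector of $\Lambda(G)=\{(x_1,\dots,x_m)\in G^m:\bigcap_i x_i\neq\emptyset\}$, $b(U)$ that of $\Lambda(U)=\{(x_1,\dots,x_m)\in U^m:\bigcap_i x_i\in U\}$, $b(K)$ that of $\Lambda(K)=\{(x_1,\dots,x_m)\in K^m:\bigcap_i x_i\neq\emptyset\}$, and for $X_1,\dots,X_m\in\{U,K\}$ let $b(X_1,\dots,X_m)$ be that of $\Lambda(X_1,\dots,X_m)=\{(x_1,\dots,x_m)\in X_1\times\dots\times X_m:\bigcap_i x_i\in K\}$. Then componentwise $$b(G)\le b(U)+b(K)+\sum_{(X_1,\dots,X_m)\in\{U,K\}^m} b(X_1,\dots,X_m).$$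
   Context: A finite abstract simplicial complex $G$ is a finite set of nonempty finite sets (simplices) closed under taking nonempty subsets; $\dim(x)=|x|-1$. A subcomplex $K\subseteq G$ is a subset itself closed under taking nonempty subsets; $U=G\setminus K$. Fix a total order on the vertices; write $x=(v_0,\dots,v_p)$ with increasing vertices and $x^{(i)}=x\setminus\{v_i\}$. For a finite set $\Lambda$ of $m$-tuples of simplices, define $d_\Lambda$ on real functions on $\Lambda$ by $(d_\Lambda f)(x_1,\dots,x_m)=\sum_{l=1}^m(-1)^{\dim x_1+\dots+\dim x_{l-1}}\sum_{i=0}^{\dim x_l}(-1)^i f(x_1,\dots,x_l^{(i)},\dots,x_m)$, omitting terms whose argument is not a tuple in $\Lambda$. As matrices indexed by $\Lambda$, $D_\Lambda=d_\Lambda+d_\Lambda^T$ and $L_\Lambda=D_\Lambda^2$. A tuple is a $k$-tuple if $\sum_l\dim x_l=k$; $b_k(\Lambda)$ is the dimension of the kernel of the diagonal block of $L_\Lambda$ indexed by the $k$-tuples of $\Lambda$, and the Betti vector is $(b_0(\Lambda),b_1(\Lambda),\dots)$. -}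

module Defs where

open import Data.Nat as ℕ using (ℕ; zero; suc; _∸_; _≤_)
open import Data.Bool using (Bool; true; false; if_then_else_)
open import Data.Fin using (Fin)
open import Data.List as L using (List; []; _∷_; length; filter; concatMap; allFin; lookup; removeAt)
open import Data.List.Relation.Unary.Unique.Propositional using (Unique)
open import Data.List.Relation.Unary.Linked using (Linked)
open import Data.List.Relation.Unary.All using (All)
open import Data.List.Relation.Binary.Sublist.Propositional using (_⊆_)
open import Data.List.Membership.Propositional using (_∈_)
import Data.List.Properties as LP
import Data.List.Membership.DecPropositional as DecMem
open import Data.Vec as V using (Vec; []; _∷_; _[_]≔_)
import Data.Vec.Properties as VP
open import Data.Rational as ℚ using (ℚ; 0ℚ; 1ℚ; _+_; _*_; -_)
open import Data.Product using (Σ; ∃; _×_)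
open import Relation.Binary.PropositionalEquality using (_≡_; _≢_)
open import Relation.Binary.Definitions using (DecidableEquality)
open import Relation.Nullary using (¬?)
open import Relation.Nullary.Decidable using (⌊_⌋)

-- A simplex
-- is represented by the strictly increasing list of its vertices
-- x = (v_0,...,v_p); dim x = length x - 1.  Subsets of x correspond
-- exactly to sublists of this list.

Simplex : Set
Simplex = List ℕ

IsSimplex : Simplex → Set
IsSimplex x = (x ≢ []) × Linked ℕ._<_ x

dim : Simplex → ℕ
dim x = length x ∸ 1

_≟S_ : DecidableEquality Simplex
_≟S_ = LP.≡-dec ℕ._≟_

open DecMem _≟S_ using () renaming (_∈?_ to _∈S?_)
open DecMem ℕ._≟_ using () renaming (_∈?_ to _∈ℕ?_)

IsComplex : List Simplex → Set
IsComplex G = Unique G × All IsSimplex G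
            × (∀ {x y} → x ∈ G → y ⊆ x → y ≢ [] → y ∈ G)

IsSubcomplex : List Simplex → List Simplex → Set
IsSubcomplex K G = IsComplex K × (∀ {x} → x ∈ K → x ∈ G)

diff : List Simplex → List Simplex → List Simplex
diff G K = filter (λ x → ¬? (x ∈S? K)) G

inter : Simplex → Simplex → Simplex
inter x y = filter (λ v → v ∈ℕ? y) x

-- intersection of the entries of a tuple (only used for m ≥ 1)
⋂ : ∀ {m} → Vec Simplex m → Simplex
⋂ [] = []
⋂ (x ∷ []) = x
⋂ (x ∷ y ∷ xs) = inter x (⋂ (y ∷ xs))

prodL : ∀ {A : Set} {m} → Vec (List A) m → List (Vec A m)
prodL [] = [] ∷ []
prodL (X ∷ Xs) = concatMap (λ a → L.map (a ∷_) (prodL Xs)) X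

power : ∀ {A : Set} → List A → (m : ℕ) → List (Vec A m)
power X m = prodL (V.replicate m X)

ΛG : List Simplex → (m : ℕ) → List (Vec Simplex m)
ΛG G m = filter (λ t → ¬? (⋂ t ≟S [])) (power G m)

ΛU : List Simplex → List Simplex → (m : ℕ) → List (Vec Simplex m)
ΛU G K m = filter (λ t → ⋂ t ∈S? diff G K) (power (diff G K) m)

ΛK : List Simplex → (m : ℕ) → List (Vec Simplex m)
ΛK K m = ΛG K m

ΛX : List Simplex → List Simplex → (m : ℕ) → Vec Bool m → List (Vec Simplex m)
ΛX G K m X =
  filter (λ t → ⋂ t ∈S? K) (prodL (V.map (λ b → if b then diff G K else K) X))

sumℚ : List ℚ → ℚ
sumℚ = L.foldr _+_ 0ℚ

sumℕ : List ℕ → ℕ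
sumℕ = L.foldr ℕ._+_ 0

Matrix : ℕ → Set
Matrix n = Fin n → Fin n → ℚ

mulV : ∀ {n} → Matrix n → (Fin n → ℚ) → Fin n → ℚ
mulV M v i = sumℚ (L.map (λ j → M i j * v j) (allFin _))

mulM : ∀ {n} → Matrix n → Matrix n → Matrix n
mulM M N i j = sumℚ (L.map (λ c → M i c * N c j) (allFin _))

lincomb : ∀ {n r} → (Fin r → ℚ) → (Fin r → Fin n → ℚ) → Fin n → ℚ
lincomb c v i = sumℚ (L.map (λ a → c a * v a i) (allFin _))

IsKernelDim : ∀ {n} → Matrix n → ℕ → Set
IsKernelDim {n} M r =
  Σ (Fin r → Fin n → ℚ) λ v →
    (∀ a i → mulV M (v a) i ≡ 0ℚ)
  × (∀ (c : Fin r → ℚ) → (∀ i → lincomb c v i ≡ 0ℚ) → ∀ a → c a ≡ 0ℚ)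
  × (∀ (w : Fin n → ℚ) → (∀ i → mulV M w i ≡ 0ℚ) →
       ∃ λ (c : Fin r → ℚ) → ∀ i → w i ≡ lincomb c v i)

sign : ℕ → ℚ
sign zero = 1ℚ
sign (suc k) = - sign k

preDim : ∀ {m} → Vec Simplex m → Fin m → ℕ
preDim (x ∷ xs) Fin.zero = 0
preDim (x ∷ xs) (Fin.suc l) = dim x ℕ.+ preDim xs l

face : ∀ {m} (t : Vec Simplex m) (l : Fin m) → Fin (length (V.lookup t l)) → Vec Simplex m
face t l i = t [ l ]≔ removeAt (V.lookup t l) i

δ : ∀ {m} → Vec Simplex m → Vec Simplex m → ℚ
δ t s = if ⌊ VP.≡-dec _≟S_ t s ⌋ then 1ℚ else 0ℚ

-- coefficient of f(s) in (d_Λ f)(t)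
dEntry : ∀ {m} → Vec Simplex m → Vec Simplex m → ℚ
dEntry {m} t s =
  sumℚ (L.map (λ l →
    sumℚ (L.map (λ i → sign (preDim t l ℕ.+ Data.Fin.toℕ i) * δ (face t l i) s)
                (allFin (length (V.lookup t l)))))
    (allFin m))

module _ {m : ℕ} (Λ : List (Vec Simplex m)) where

  dMat : Matrix (length Λ)
  dMat a b = dEntry (lookup Λ a) (lookup Λ b)

  DMat : Matrix (length Λ)
  DMat a b = dMat a b + dMat b a

  LMat : Matrix (length Λ)
  LMat = mulM DMat DMat

  deg : Vec Simplex m → ℕ
  deg t = V.foldr _ (λ x acc → dim x ℕ.+ acc) 0 t

  kIdx : ℕ → List (Fin (length Λ))
  kIdx k = filter (λ a → deg (lookup Λ a) ℕ.≟ k) (allFin (length Λ))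

  LBlock : (k : ℕ) → Matrix (length (kIdx k))
  LBlock k i j = LMat (lookup (kIdx k) i) (lookup (kIdx k) j)

  IsBetti : ℕ → ℕ → Set
  IsBetti k r = IsKernelDim (LBlock k) r

-- Λ(G) is the disjoint union of Λ(U) and the Λ(X₁,…,X_m). Listing Λ(U) first and then the
-- patterns in decreasing lexicographic order, no tuple has a face in an earlier piece (K is
-- closed under faces), so the pieces filter the complex. Since D is symmetric, the kernel of a
-- diagonal block of L = D² consists of the f with D f = 0, i.e. the harmonic f (d f = 0 and
-- dᵀ f = 0), and b_k is the dimension of the harmonic functions in degree k.
-- This dimension is subadditive along a filtration step A ⊂ A ⊕ B. Project a harmonic h on
-- A ⊕ B off the coboundaries of A: the rest is harmonic on A. For combinations whose A-parts
-- cancel, projecting further off the coboundaries of B leaves a function harmonic on B. A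
-- combination whose B-part vanishes too is, in the middle degree, a sum of coboundaries; being
-- closed it is orthogonal to them, hence to itself, hence zero.
module Submission where

module FiniteSum where

  open import Function using (_∘_; id)
  open import Data.Nat using (ℕ; zero; suc)
  open import Data.Fin using (Fin; zero; suc; punchIn)
  open import Data.List using (List; []; _∷_; _++_; allFin; map)
  import Data.List.Properties as LP
  open import Data.List.Relation.Unary.Any using (here; there)
  open import Data.List.Membership.Propositional using (_∈_)
  open import Data.Rational using (ℚ; 0ℚ; 1ℚ; _+_; _*_; -_; _≤_; 1/_; ≢-nonZero; nonNegative; nonPositive)
  open import Data.Rational.Properties
  open import Data.Rational.Solver using (module +-*-Solver)
  open import Data.Sum using (inj₁; inj₂)
  open import Relation.Binary.PropositionalEquality
  open import Relation.Nullary using (yes; no)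
  open +-*-Solver using (solve; _:=_; _:+_)

  private variable A B : Set

  ∑ : List A → (A → ℚ) → ℚ
  ∑ [] f = 0ℚ
  ∑ (x ∷ xs) f = f x + ∑ xs f

  syntax ∑ xs (λ x → e) = ∑[ x ∈ xs ] e

  ∑Fin : (n : ℕ) → (Fin n → ℚ) → ℚ
  ∑Fin n = ∑ (allFin n)

  syntax ∑Fin n (λ i → e) = ∑[ i < n ] e

  ∑-cong-on : ∀ (xs : List A) {f g : A → ℚ} → (∀ x → x ∈ xs → f x ≡ g x) → ∑ xs f ≡ ∑ xs g
  ∑-cong-on [] h = refl
  ∑-cong-on (x ∷ xs) h = cong₂ _+_ (h x (here refl)) (∑-cong-on xs (λ y y∈xs → h y (there y∈xs)))

  ∑-cong : ∀ (xs : List A) {f g : A → ℚ} → (∀ x → f x ≡ g x) → ∑ xs f ≡ ∑ xs g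
  ∑-cong xs h = ∑-cong-on xs (λ x _ → h x)

  ∑-zero-on : ∀ (xs : List A) {f : A → ℚ} → (∀ x → x ∈ xs → f x ≡ 0ℚ) → ∑ xs f ≡ 0ℚ
  ∑-zero-on [] h = refl
  ∑-zero-on (x ∷ xs) h
    rewrite h x (here refl) | ∑-zero-on xs (λ y y∈xs → h y (there y∈xs)) = refl

  ∑-zero : ∀ (xs : List A) {f : A → ℚ} → (∀ x → f x ≡ 0ℚ) → ∑ xs f ≡ 0ℚ
  ∑-zero xs h = ∑-zero-on xs (λ x _ → h x)

  ∑-+ : ∀ (xs : List A) (f g : A → ℚ) → ∑[ x ∈ xs ] (f x + g x) ≡ ∑ xs f + ∑ xs g
  ∑-+ [] f g = refl
  ∑-+ (x ∷ xs) f g rewrite ∑-+ xs f g =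
    solve 4 (λ a b c d → (a :+ b) :+ (c :+ d) := (a :+ c) :+ (b :+ d)) refl (f x) (g x) (∑ xs f) (∑ xs g)

  ∑-*ˡ : ∀ (xs : List A) (k : ℚ) (f : A → ℚ) → ∑[ x ∈ xs ] (k * f x) ≡ k * ∑ xs f
  ∑-*ˡ [] k f = sym (*-zeroʳ k)
  ∑-*ˡ (x ∷ xs) k f rewrite ∑-*ˡ xs k f = sym (*-distribˡ-+ k (f x) (∑ xs f))

  ∑-*ʳ : ∀ (xs : List A) (k : ℚ) (f : A → ℚ) → ∑[ x ∈ xs ] (f x * k) ≡ ∑ xs f * k
  ∑-*ʳ xs k f = trans (∑-cong xs (λ x → *-comm (f x) k)) (trans (∑-*ˡ xs k f) (*-comm k _))

  ∑-neg : ∀ (xs : List A) (f : A → ℚ) → ∑[ x ∈ xs ] (- f x) ≡ - ∑ xs f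
  ∑-neg [] f = refl
  ∑-neg (x ∷ xs) f rewrite ∑-neg xs f = sym (neg-distrib-+ (f x) (∑ xs f))

  ∑-+-*ˡ : ∀ (xs : List A) (f g : A → ℚ) (k : ℚ) → ∑[ x ∈ xs ] (f x + k * g x) ≡ ∑ xs f + k * ∑ xs g
  ∑-+-*ˡ xs f g k = trans (∑-+ xs f (λ x → k * g x)) (cong (∑ xs f +_) (∑-*ˡ xs k g))

  ∑-minus : ∀ (xs : List A) (f g : A → ℚ) → ∑[ x ∈ xs ] (f x + - g x) ≡ ∑ xs f + - ∑ xs g
  ∑-minus xs f g = trans (∑-+ xs f (λ x → - g x)) (cong (∑ xs f +_) (∑-neg xs g))

  ∑-++ : ∀ (xs ys : List A) (f : A → ℚ) → ∑ (xs ++ ys) f ≡ ∑ xs f + ∑ ys f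
  ∑-++ [] ys f = sym (+-identityˡ _)
  ∑-++ (x ∷ xs) ys f rewrite ∑-++ xs ys f = sym (+-assoc (f x) (∑ xs f) (∑ ys f))

  ∑-++-zeroˡ : ∀ (xs ys : List A) (f : A → ℚ) → ∑ (xs ++ ys) f ≡ 0ℚ → ∑ ys f ≡ 0ℚ → ∑ xs f ≡ 0ℚ
  ∑-++-zeroˡ xs ys f total≡0 ys≡0 =
    trans (sym (+-identityʳ _)) (trans (cong (∑ xs f +_) (sym ys≡0)) (trans (sym (∑-++ xs ys f)) total≡0))

  ∑-++-zeroʳ : ∀ (xs ys : List A) (f : A → ℚ) → ∑ (xs ++ ys) f ≡ 0ℚ → ∑ xs f ≡ 0ℚ → ∑ ys f ≡ 0ℚ
  ∑-++-zeroʳ xs ys f total≡0 xs≡0 =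
    trans (sym (+-identityˡ _)) (trans (cong (_+ ∑ ys f) (sym xs≡0)) (trans (sym (∑-++ xs ys f)) total≡0))

  ∑-comm : ∀ (xs : List A) (ys : List B) (f : A → B → ℚ) →
    ∑[ a ∈ xs ] ∑[ b ∈ ys ] f a b ≡ ∑[ b ∈ ys ] ∑[ a ∈ xs ] f a b
  ∑-comm [] ys f = sym (∑-zero ys (λ _ → refl))
  ∑-comm (x ∷ xs) ys f rewrite ∑-comm xs ys f = sym (∑-+ ys (f x) (λ b → ∑[ a ∈ xs ] f a b))

  ∑-map : ∀ (g : A → B) (xs : List A) (f : B → ℚ) → ∑ (map g xs) f ≡ ∑ xs (f ∘ g)
  ∑-map g [] f = refl
  ∑-map g (x ∷ xs) f = cong (f (g x) +_) (∑-map g xs f)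

  ∑Fin-suc : ∀ n (f : Fin (suc n) → ℚ) → ∑Fin (suc n) f ≡ f zero + ∑Fin n (f ∘ suc)
  ∑Fin-suc n f =
    cong (f zero +_) (trans (cong (λ l → ∑ l f) (sym (LP.map-tabulate id suc))) (∑-map suc (allFin n) f))

  ∑Fin-punchIn : ∀ {n} (i : Fin (suc n)) (f : Fin (suc n) → ℚ) → ∑Fin (suc n) f ≡ f i + ∑Fin n (f ∘ punchIn i)
  ∑Fin-punchIn zero f = ∑Fin-suc _ f
  ∑Fin-punchIn {suc n} (suc i) f = begin
      ∑Fin (suc (suc n)) f
    ≡⟨ ∑Fin-suc (suc n) f ⟩
      f zero + ∑Fin (suc n) (f ∘ suc)
    ≡⟨ cong (f zero +_) (∑Fin-punchIn i (f ∘ suc)) ⟩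
      f zero + (f (suc i) + ∑Fin n (f ∘ suc ∘ punchIn i))
    ≡⟨ solve 3 (λ a b c → a :+ (b :+ c) := b :+ (a :+ c)) refl (f zero) (f (suc i)) (∑Fin n (f ∘ suc ∘ punchIn i)) ⟩
      f (suc i) + (f zero + ∑Fin n (f ∘ suc ∘ punchIn i))
    ≡⟨ cong (f (suc i) +_) (sym (∑Fin-suc n (f ∘ punchIn (suc i)))) ⟩
      f (suc i) + ∑Fin (suc n) (f ∘ punchIn (suc i))
    ∎ where open ≡-Reasoning

  basis : ∀ {n} → Fin n → Fin n → ℚ
  basis zero zero = 1ℚ
  basis zero (suc j) = 0ℚ
  basis (suc i) zero = 0ℚ
  basis (suc i) (suc j) = basis i j

  ∑Fin-basis : ∀ {n} (i : Fin n) (g : Fin n → ℚ) → ∑[ j < n ] (basis i j * g j) ≡ g i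
  ∑Fin-basis {suc n} zero g = begin
      ∑Fin (suc n) (λ j → basis zero j * g j)
    ≡⟨ ∑Fin-suc n (λ j → basis zero j * g j) ⟩
      1ℚ * g zero + ∑[ j < n ] (0ℚ * g (suc j))
    ≡⟨ cong₂ _+_ (*-identityˡ (g zero)) (∑-zero (allFin n) (λ j → *-zeroˡ (g (suc j)))) ⟩
      g zero + 0ℚ
    ≡⟨ +-identityʳ (g zero) ⟩
      g zero ∎ where open ≡-Reasoning
  ∑Fin-basis {suc n} (suc i) g = begin
      ∑Fin (suc n) (λ j → basis (suc i) j * g j)
    ≡⟨ ∑Fin-suc n (λ j → basis (suc i) j * g j) ⟩
      0ℚ * g zero + ∑[ j < n ] (basis i j * g (suc j))
    ≡⟨ cong₂ _+_ (*-zeroˡ (g zero)) (∑Fin-basis i (g ∘ suc)) ⟩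
      0ℚ + g (suc i)
    ≡⟨ +-identityˡ (g (suc i)) ⟩
      g (suc i) ∎ where open ≡-Reasoning

  square-nonNeg : ∀ p → 0ℚ ≤ p * p
  square-nonNeg p with ≤-total 0ℚ p
  ... | inj₁ 0≤p = nonNegative⁻¹ _ {{nonNeg*nonNeg⇒nonNeg p {{nonNegative 0≤p}} p {{nonNegative 0≤p}}}}
  ... | inj₂ p≤0 = nonNegative⁻¹ _ {{nonPos*nonPos⇒nonPos p {{nonPositive p≤0}} p {{nonPositive p≤0}}}}

  square≡0⇒≡0 : ∀ p → p * p ≡ 0ℚ → p ≡ 0ℚ
  square≡0⇒≡0 p pp≡0 with p ≟ 0ℚ
  ... | yes p≡0 = p≡0
  ... | no p≢0 = begin
      p                   ≡⟨ sym (*-identityʳ p) ⟩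
      p * 1ℚ              ≡⟨ cong (p *_) (sym (*-inverseʳ p)) ⟩
      p * (p * 1/ p)      ≡⟨ sym (*-assoc p p (1/ p)) ⟩
      p * p * 1/ p        ≡⟨ cong (_* 1/ p) pp≡0 ⟩
      0ℚ * 1/ p           ≡⟨ *-zeroˡ (1/ p) ⟩
      0ℚ                  ∎
    where
    open ≡-Reasoning
    instance
      p≠0 = ≢-nonZero p≢0

  ∑-squares-nonNeg : ∀ (xs : List A) (f : A → ℚ) → 0ℚ ≤ ∑[ x ∈ xs ] (f x * f x)
  ∑-squares-nonNeg [] f = ≤-refl
  ∑-squares-nonNeg (x ∷ xs) f = +-mono-≤ (square-nonNeg (f x)) (∑-squares-nonNeg xs f)

  private
    nonNeg+nonNeg≡0⇒≡0 : ∀ {a b} → 0ℚ ≤ a → 0ℚ ≤ b → a + b ≡ 0ℚ → a ≡ 0ℚ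
    nonNeg+nonNeg≡0⇒≡0 {a} {b} 0≤a 0≤b a+b≡0 = ≤-antisym a≤0 0≤a
      where
      a≤0 : a ≤ 0ℚ
      a≤0 = ≤-trans (≤-reflexive (sym (+-identityʳ a))) (≤-trans (+-monoʳ-≤ a 0≤b) (≤-reflexive a+b≡0))

  ∑-squares≡0⇒≡0 : ∀ (xs : List A) (f : A → ℚ) → ∑[ x ∈ xs ] (f x * f x) ≡ 0ℚ → ∀ x → x ∈ xs → f x ≡ 0ℚ
  ∑-squares≡0⇒≡0 (y ∷ xs) f sum≡0 x (here refl) =
    square≡0⇒≡0 (f x) (nonNeg+nonNeg≡0⇒≡0 (square-nonNeg (f x)) (∑-squares-nonNeg xs f) sum≡0)
  ∑-squares≡0⇒≡0 (y ∷ xs) f sum≡0 x (there x∈xs) =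
    ∑-squares≡0⇒≡0 xs f
      (nonNeg+nonNeg≡0⇒≡0 (∑-squares-nonNeg xs f) (square-nonNeg (f y)) (trans (+-comm _ (f y * f y)) sum≡0))
      x x∈xs

module LinearAlgebra where

  open import Function using (_∘_)
  open import Data.Nat as ℕ using (ℕ; zero; suc; _<_; s<s⁻¹)
  open import Data.Nat.Properties using (m<n⇒m<1+n)
  open import Data.Fin using (Fin; zero; suc; punchIn; punchOut)
  open import Data.Fin.Properties using (all?; ¬∀⟶∃¬; punchInᵢ≢i; punchOut-cong; punchOut-punchIn) renaming (_≟_ to _≟ᶠ_)
  open import Data.List using (List; allFin)
  open import Data.List.Membership.Propositional using (_∈_)
  open import Data.Rational using (ℚ; 0ℚ; 1ℚ; _+_; _*_; -_; 1/_; NonZero; ≢-nonZero)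
  open import Data.Rational.Properties
  open import Data.Rational.Solver using (module +-*-Solver)
  open import Data.Product using (∃; _×_; _,_; proj₁; proj₂)
  open import Relation.Binary.Definitions using (_Respects_)
  open import Relation.Binary.PropositionalEquality
  open import Relation.Nullary using (yes; no)
  open import Data.Empty using (⊥-elim)
  open +-*-Solver using (solve; _:=_; _:+_; _:*_; :-_; con)
  open FiniteSum

  Nontrivial : ∀ {n} → (Fin n → ℚ) → Set
  Nontrivial c = ∃ λ i → c i ≢ 0ℚ

  Solves : ∀ {n s} → (Fin n → Fin s → ℚ) → (Fin n → ℚ) → Set
  Solves {n} C c = ∀ j → ∑[ i < n ] (c i * C i j) ≡ 0ℚ

  module _ {T : Set} where

    linComb : ∀ {n} → (Fin n → ℚ) → (Fin n → T → ℚ) → T → ℚ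
    linComb {n} c β x = ∑[ i < n ] (c i * β i x)

    residual : ∀ {n} → (T → ℚ) → (Fin n → ℚ) → (Fin n → T → ℚ) → T → ℚ
    residual y x col s = y s + - linComb x col s

    VanishesOn : List T → (T → ℚ) → Set
    VanishesOn X f = ∀ x → x ∈ X → f x ≡ 0ℚ

    -- Dimension without subspaces: every family of more than t functions whose
    -- combinations all satisfy Q is linearly dependent on X.
    Dim≤ : ((T → ℚ) → Set) → List T → ℕ → Set
    Dim≤ Q X t = ∀ n → t < n → (β : Fin n → T → ℚ) → (∀ c → Q (linComb c β)) →
      ∃ λ c → Nontrivial c × VanishesOn X (linComb c β)

    Dim≤-map : ∀ {Q Q′ : (T → ℚ) → Set} {X X′ : List T} {t} → (∀ {f} → Q f → Q′ f) →
      (∀ {f} → VanishesOn X′ f → VanishesOn X f) → Dim≤ Q′ X′ t → Dim≤ Q X t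
    Dim≤-map Q⇒Q′ vanishes⇒ dim n t<n β Q-β =
      let (c , nontrivial , vanishes) = dim n t<n β (λ c → Q⇒Q′ (Q-β c)) in c , nontrivial , vanishes⇒ vanishes

    ConstrainedDependence : ∀ {n s} → List T → (Fin n → Fin s → ℚ) → (Fin n → T → ℚ) → Set
    ConstrainedDependence X C β = ∃ λ c → Nontrivial c × Solves C c × VanishesOn X (linComb c β)

    linComb-assoc : ∀ {n r} (c : Fin n → ℚ) (y : Fin n → Fin r → ℚ) (g : Fin r → T → ℚ) x →
      linComb c (λ i → linComb (y i) g) x ≡ linComb (λ p → ∑[ i < n ] (c i * y i p)) g x
    linComb-assoc {n} {r} c y g x = begin
        ∑[ i < n ] (c i * ∑[ p < r ] (y i p * g p x))
      ≡⟨ ∑-cong (allFin n) (λ i → sym (∑-*ˡ (allFin r) (c i) (λ p → y i p * g p x))) ⟩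
        ∑[ i < n ] ∑[ p < r ] (c i * (y i p * g p x))
      ≡⟨ ∑-comm (allFin n) (allFin r) (λ i p → c i * (y i p * g p x)) ⟩
        ∑[ p < r ] ∑[ i < n ] (c i * (y i p * g p x))
      ≡⟨ ∑-cong (allFin r) (λ p → trans (∑-cong (allFin n) (λ i → sym (*-assoc (c i) (y i p) (g p x))))
                                       (∑-*ʳ (allFin n) (g p x) (λ i → c i * y i p))) ⟩
        ∑[ p < r ] (∑[ i < n ] (c i * y i p) * g p x) ∎
      where open ≡-Reasoning

    ∑-*-linComb : ∀ {n} (X : List T) (g : T → ℚ) (c : Fin n → ℚ) (β : Fin n → T → ℚ) →
      ∑[ s ∈ X ] (g s * linComb c β s) ≡ ∑[ i < n ] (c i * ∑[ s ∈ X ] (g s * β i s))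
    ∑-*-linComb {n} X g c β = begin
        ∑[ s ∈ X ] (g s * ∑[ i < n ] (c i * β i s))
      ≡⟨ ∑-cong X (λ s → sym (∑-*ˡ (allFin n) (g s) (λ i → c i * β i s))) ⟩
        ∑[ s ∈ X ] ∑[ i < n ] (g s * (c i * β i s))
      ≡⟨ ∑-comm X (allFin n) (λ s i → g s * (c i * β i s)) ⟩
        ∑[ i < n ] ∑[ s ∈ X ] (g s * (c i * β i s))
      ≡⟨ ∑-cong (allFin n) (λ i → trans (∑-cong X (λ s → solve 3 (λ g c b → g :* (c :* b) := c :* (g :* b)) refl (g s) (c i) (β i s)))
                                        (∑-*ˡ X (c i) (λ s → g s * β i s))) ⟩
        ∑[ i < n ] (c i * ∑[ s ∈ X ] (g s * β i s)) ∎
      where open ≡-Reasoning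

    linComb-+ : ∀ {n} (c : Fin n → ℚ) (f g : Fin n → T → ℚ) x →
      linComb c (λ i s → f i s + g i s) x ≡ linComb c f x + linComb c g x
    linComb-+ {n} c f g x = trans (∑-cong (allFin n) (λ i → *-distribˡ-+ (c i) (f i x) (g i x))) (∑-+ (allFin n) _ _)

    linComb-minus : ∀ {n} (c : Fin n → ℚ) (f g : Fin n → T → ℚ) x →
      linComb c (λ i s → f i s + - g i s) x ≡ linComb c f x + - linComb c g x
    linComb-minus {n} c f g x =
      trans (∑-cong (allFin n) (λ i → trans (*-distribˡ-+ (c i) (f i x) (- g i x)) (cong (c i * f i x +_) (sym (neg-distribʳ-* (c i) (g i x))))))
            (∑-minus (allFin n) _ _)

    module Elimination {n s : ℕ} (C : Fin (suc n) → Fin (suc s) → ℚ) (i₀ : Fin (suc n)) (pivot≢0 : C i₀ zero ≢ 0ℚ) where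

      private instance
        pivot-nonZero : NonZero (C i₀ zero)
        pivot-nonZero = ≢-nonZero pivot≢0

      ratio : Fin n → ℚ
      ratio i = C (punchIn i₀ i) zero * 1/ C i₀ zero

      reduce : (Fin (suc n) → ℚ) → Fin n → ℚ
      reduce g i = g (punchIn i₀ i) + - (ratio i * g i₀)

      reducedSystem : Fin n → Fin s → ℚ
      reducedSystem i j = reduce (λ i′ → C i′ (suc j)) i

      extend : (Fin n → ℚ) → Fin (suc n) → ℚ
      extend c i with i ≟ᶠ i₀
      ... | yes _ = - ∑[ i′ < n ] (c i′ * ratio i′)
      ... | no i≢i₀ = c (punchOut (i≢i₀ ∘ sym))

      extend-i₀ : ∀ c → extend c i₀ ≡ - ∑[ i′ < n ] (c i′ * ratio i′)
      extend-i₀ c with i₀ ≟ᶠ i₀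
      ... | yes _ = refl
      ... | no i₀≢i₀ = ⊥-elim (i₀≢i₀ refl)

      extend-punchIn : ∀ c i → extend c (punchIn i₀ i) ≡ c i
      extend-punchIn c i with punchIn i₀ i ≟ᶠ i₀
      ... | yes eq = ⊥-elim (punchInᵢ≢i i₀ i eq)
      ... | no _ = cong c (trans (punchOut-cong i₀ refl) (punchOut-punchIn i₀))

      ∑-extend : ∀ c (g : Fin (suc n) → ℚ) → ∑[ i < suc n ] (extend c i * g i) ≡ ∑[ i < n ] (c i * reduce g i)
      ∑-extend c g = begin
          ∑[ i < suc n ] (extend c i * g i)
        ≡⟨ ∑Fin-punchIn i₀ (λ i → extend c i * g i) ⟩
          extend c i₀ * g i₀ + ∑[ i < n ] (extend c (punchIn i₀ i) * g (punchIn i₀ i))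
        ≡⟨ cong₂ _+_ (cong (_* g i₀) (extend-i₀ c)) (∑-cong (allFin n) (λ i → cong (_* g (punchIn i₀ i)) (extend-punchIn c i))) ⟩
          - B * g i₀ + A
        ≡⟨ solve 3 (λ B g₀ A → :- B :* g₀ :+ A := A :+ (:- g₀) :* B) refl B (g i₀) A ⟩
          A + (- g i₀) * B
        ≡⟨ sym (∑-+-*ˡ (allFin n) (λ i → c i * g (punchIn i₀ i)) (λ i → c i * ratio i) (- g i₀)) ⟩
          ∑[ i < n ] (c i * g (punchIn i₀ i) + (- g i₀) * (c i * ratio i))
        ≡⟨ ∑-cong (allFin n) (λ i → solve 4 (λ c a ρ g₀ → c :* a :+ (:- g₀) :* (c :* ρ) := c :* (a :+ :- (ρ :* g₀)))
                                             refl (c i) (g (punchIn i₀ i)) (ratio i) (g i₀)) ⟩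
          ∑[ i < n ] (c i * reduce g i) ∎
        where
        open ≡-Reasoning
        A = ∑[ i < n ] (c i * g (punchIn i₀ i))
        B = ∑[ i < n ] (c i * ratio i)

      reduce-pivotColumn : ∀ i → reduce (λ i′ → C i′ zero) i ≡ 0ℚ
      reduce-pivotColumn i = begin
          a + - (a * 1/ p * p)      ≡⟨ cong (λ w → a + - w) (*-assoc a (1/ p) p) ⟩
          a + - (a * (1/ p * p))    ≡⟨ cong (λ w → a + - (a * w)) (*-inverseˡ p) ⟩
          a + - (a * 1ℚ)            ≡⟨ cong (λ w → a + - w) (*-identityʳ a) ⟩
          a + - a                   ≡⟨ +-inverseʳ a ⟩
          0ℚ                        ∎
        where
        open ≡-Reasoning
        a = C (punchIn i₀ i) zero
        p = C i₀ zero

      extend-solves : ∀ c → Solves reducedSystem c → Solves C (extend c)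
      extend-solves c sol zero = trans (∑-extend c (λ i → C i zero))
        (∑-zero (allFin n) (λ i → trans (cong (c i *_) (reduce-pivotColumn i)) (*-zeroʳ (c i))))
      extend-solves c sol (suc j) = trans (∑-extend c (λ i → C i (suc j))) (sol j)

      extend-nontrivial : ∀ {c} → Nontrivial c → Nontrivial (extend c)
      extend-nontrivial (i , cᵢ≢0) = punchIn i₀ i , λ eq → cᵢ≢0 (trans (sym (extend-punchIn _ i)) eq)

    -- Each linear constraint on the coefficients costs at most one dimension.
    Dim≤-constrained : ∀ s {Q : (T → ℚ) → Set} {X : List T} {t : ℕ} → Q Respects _≗_ → Dim≤ Q X t →
      ∀ n → s ℕ.+ t < n → (C : Fin n → Fin s → ℚ) (β : Fin n → T → ℚ) →
      (∀ c → Solves C c → Q (linComb c β)) → ConstrainedDependence X C β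
    Dim≤-constrained zero resp dim n t<n C β hyp with dim n t<n β (λ c → hyp c (λ ()))
    ... | c , nontrivial , vanishes = c , nontrivial , (λ ()) , vanishes
    Dim≤-constrained (suc s) resp dim (suc n) s+t<n C β hyp with all? (λ i → C i zero ≟ 0ℚ)
    ... | yes column₀≡0 =
      let (c , nontrivial , sol , vanishes) = Dim≤-constrained s resp dim (suc n) (m<n⇒m<1+n (s<s⁻¹ s+t<n)) (λ i j → C i (suc j)) β
            (λ c sol → hyp c (λ { zero → equation₀ c ; (suc j) → sol j }))
      in c , nontrivial , (λ { zero → equation₀ c ; (suc j) → sol j }) , vanishes
      where
      equation₀ : ∀ c → ∑[ i < suc n ] (c i * C i zero) ≡ 0ℚ
      equation₀ c = ∑-zero (allFin (suc n)) (λ i → trans (cong (c i *_) (column₀≡0 i)) (*-zeroʳ (c i)))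
    ... | no ¬column₀≡0 with ¬∀⟶∃¬ (suc n) _ (λ i → C i zero ≟ 0ℚ) ¬column₀≡0
    ... | i₀ , pivot≢0 =
      let (c , nontrivial , sol , vanishes) = Dim≤-constrained s resp dim n (s<s⁻¹ s+t<n) reducedSystem reducedFamily
            (λ c sol → resp (λ x → ∑-extend c (λ i → β i x)) (hyp (extend c) (extend-solves c sol)))
      in extend c , extend-nontrivial nontrivial , extend-solves c sol ,
         (λ x x∈X → trans (∑-extend c (λ i → β i x)) (vanishes x x∈X))
      where
      open Elimination C i₀ pivot≢0
      reducedFamily : Fin n → T → ℚ
      reducedFamily i x = reduce (λ i′ → β i′ x) i

  module InnerProduct {T : Set} (X : List T) where

    ⟪_,_⟫ : (T → ℚ) → (T → ℚ) → ℚ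
    ⟪ f , g ⟫ = ∑[ s ∈ X ] (f s * g s)

    ⟪⟫-comm : ∀ f g → ⟪ f , g ⟫ ≡ ⟪ g , f ⟫
    ⟪⟫-comm f g = ∑-cong X (λ s → *-comm (f s) (g s))

    ⟪⟫-minus-* : ∀ f g h α → ⟪ f , (λ s → g s + - (α * h s)) ⟫ ≡ ⟪ f , g ⟫ + - (α * ⟪ f , h ⟫)
    ⟪⟫-minus-* f g h α = begin
        ⟪ f , (λ s → g s + - (α * h s)) ⟫
      ≡⟨ ∑-cong X (λ s → solve 4 (λ f g h α → f :* (g :+ :- (α :* h)) := f :* g :+ (:- α) :* (f :* h)) refl (f s) (g s) (h s) α) ⟩
        ∑[ s ∈ X ] (f s * g s + (- α) * (f s * h s))
      ≡⟨ ∑-+-*ˡ X _ _ (- α) ⟩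
        ⟪ f , g ⟫ + (- α) * ⟪ f , h ⟫
      ≡⟨ cong (⟪ f , g ⟫ +_) (sym (neg-distribˡ-* α ⟪ f , h ⟫)) ⟩
        ⟪ f , g ⟫ + - (α * ⟪ f , h ⟫) ∎
      where open ≡-Reasoning

    ⟪⟫-multiple-of-norm : ∀ f g → ∃ λ α → ⟪ f , g ⟫ ≡ α * ⟪ f , f ⟫
    ⟪⟫-multiple-of-norm f g with ⟪ f , f ⟫ ≟ 0ℚ
    ... | yes ‖f‖≡0 = 0ℚ , trans (∑-zero-on X (λ s s∈X → trans (cong (_* g s) (∑-squares≡0⇒≡0 X f ‖f‖≡0 s s∈X)) (*-zeroˡ (g s))))
                                  (sym (*-zeroˡ ⟪ f , f ⟫))
    ... | no ‖f‖≢0 = ⟪ f , g ⟫ * 1/ ⟪ f , f ⟫ , sym (begin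
        ⟪ f , g ⟫ * 1/ ⟪ f , f ⟫ * ⟪ f , f ⟫   ≡⟨ *-assoc ⟪ f , g ⟫ _ _ ⟩
        ⟪ f , g ⟫ * (1/ ⟪ f , f ⟫ * ⟪ f , f ⟫) ≡⟨ cong (⟪ f , g ⟫ *_) (*-inverseˡ ⟪ f , f ⟫) ⟩
        ⟪ f , g ⟫ * 1ℚ                         ≡⟨ *-identityʳ _ ⟩
        ⟪ f , g ⟫                              ∎)
      where
      open ≡-Reasoning
      instance
        ‖f‖-nonZero : NonZero ⟪ f , f ⟫
        ‖f‖-nonZero = ≢-nonZero ‖f‖≢0

    -- Gram–Schmidt: orthogonalise the first column against the others, then
    -- remove its component from the residual of the others.
    module ProjectionStep {n} (col : Fin (suc n) → T → ℚ) (y : T → ℚ)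
      (x′ : Fin n → ℚ) (r⊥rest : ∀ q → ⟪ col (suc q) , residual y x′ (col ∘ suc) ⟫ ≡ 0ℚ)
      (z : Fin n → ℚ) (c′⊥rest : ∀ q → ⟪ col (suc q) , residual (col zero) z (col ∘ suc) ⟫ ≡ 0ℚ) where

      private
        rest = col ∘ suc
        r = residual y x′ rest
        c′ = residual (col zero) z rest
        α = proj₁ (⟪⟫-multiple-of-norm c′ r)
        ⟪c′,r⟫≡α‖c′‖ = proj₂ (⟪⟫-multiple-of-norm c′ r)

        r′ : T → ℚ
        r′ s = r s + - (α * c′ s)

      x : Fin (suc n) → ℚ
      x zero = α
      x (suc i) = x′ i + - (α * z i)

      private
        residual≡r′ : ∀ s → residual y x col s ≡ r′ s
        residual≡r′ s = begin
            residual y x col s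
          ≡⟨ cong (λ w → y s + - w) (∑Fin-suc n (λ i → x i * col i s)) ⟩
            y s + - (α * col zero s + ∑[ i < n ] ((x′ i + - (α * z i)) * rest i s))
          ≡⟨ cong (λ w → y s + - (α * col zero s + w))
               (trans (∑-cong (allFin n) (λ i → solve 4 (λ a α b r → (a :+ :- (α :* b)) :* r := a :* r :+ (:- α) :* (b :* r)) refl (x′ i) α (z i) (rest i s)))
                      (∑-+-*ˡ (allFin n) _ _ (- α))) ⟩
            y s + - (α * col zero s + (linComb x′ rest s + (- α) * linComb z rest s))
          ≡⟨ solve 5 (λ y α c a b → y :+ :- (α :* c :+ (a :+ (:- α) :* b)) := y :+ :- a :+ :- (α :* (c :+ :- b)))
                     refl (y s) α (col zero s) (linComb x′ rest s) (linComb z rest s) ⟩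
            r′ s ∎
          where open ≡-Reasoning

        r′⊥rest : ∀ q → ⟪ rest q , r′ ⟫ ≡ 0ℚ
        r′⊥rest q = begin
            ⟪ rest q , r′ ⟫                          ≡⟨ ⟪⟫-minus-* (rest q) r c′ α ⟩
            ⟪ rest q , r ⟫ + - (α * ⟪ rest q , c′ ⟫) ≡⟨ cong₂ (λ a b → a + - (α * b)) (r⊥rest q) (c′⊥rest q) ⟩
            0ℚ + - (α * 0ℚ)                          ≡⟨ cong (λ w → 0ℚ + - w) (*-zeroʳ α) ⟩
            0ℚ                                       ∎
          where open ≡-Reasoning

        r′⊥col₀ : ⟪ col zero , r′ ⟫ ≡ 0ℚ
        r′⊥col₀ = begin
            ⟪ col zero , r′ ⟫
          ≡⟨ ∑-cong X (λ s → cong (_* r′ s) (solve 2 (λ c l → c := c :+ :- l :+ l) refl (col zero s) (linComb z rest s))) ⟩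
            ∑[ s ∈ X ] ((c′ s + linComb z rest s) * r′ s)
          ≡⟨ trans (∑-cong X (λ s → *-distribʳ-+ (r′ s) (c′ s) (linComb z rest s))) (∑-+ X _ _) ⟩
            ⟪ c′ , r′ ⟫ + ⟪ linComb z rest , r′ ⟫
          ≡⟨ cong₂ _+_ (⟪⟫-minus-* c′ r c′ α)
               (trans (⟪⟫-comm (linComb z rest) r′) (trans (∑-*-linComb X r′ z rest)
                 (∑-zero (allFin n) (λ i → trans (cong (z i *_) (trans (⟪⟫-comm r′ (rest i)) (r′⊥rest i))) (*-zeroʳ (z i)))))) ⟩
            ⟪ c′ , r ⟫ + - (α * ⟪ c′ , c′ ⟫) + 0ℚ
          ≡⟨ cong (λ w → w + - (α * ⟪ c′ , c′ ⟫) + 0ℚ) ⟪c′,r⟫≡α‖c′‖ ⟩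
            α * ⟪ c′ , c′ ⟫ + - (α * ⟪ c′ , c′ ⟫) + 0ℚ
          ≡⟨ solve 1 (λ a → a :+ :- a :+ con 0ℚ := con 0ℚ) refl (α * ⟪ c′ , c′ ⟫) ⟩
            0ℚ ∎
          where open ≡-Reasoning

        r′⊥col : ∀ q → ⟪ col q , r′ ⟫ ≡ 0ℚ
        r′⊥col zero = r′⊥col₀
        r′⊥col (suc q) = r′⊥rest q

      residual⊥col : ∀ q → ⟪ col q , residual y x col ⟫ ≡ 0ℚ
      residual⊥col q = trans (∑-cong X (λ s → cong (col q s *_) (residual≡r′ s))) (r′⊥col q)

    project : ∀ n (col : Fin n → T → ℚ) (y : T → ℚ) → ∃ λ x → ∀ q → ⟪ col q , residual y x col ⟫ ≡ 0ℚ
    project zero col y = (λ ()) , (λ ())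
    project (suc n) col y with project n (col ∘ suc) y | project n (col ∘ suc) (col zero)
    ... | x′ , r⊥rest | z , c′⊥rest = x , residual⊥col
      where open ProjectionStep col y x′ r⊥rest z c′⊥rest

module FilteredComplex where

  open import Function using (_∘_)
  open import Data.Nat as ℕ using (ℕ; zero; suc)
  open import Data.Fin using (Fin; zero; suc)
  open import Data.List using (List; []; _∷_; _++_; allFin; map; length; lookup; foldr)
  open import Data.Nat.ListAction using (sum)
  open import Data.List.Membership.Propositional using (_∈_)
  open import Data.List.Membership.Propositional.Properties using (∈-lookup; ∈-++⁺ˡ; ∈-++⁺ʳ; ∈-++⁻)
  open import Data.List.Relation.Unary.Any as Any using (here; there)
  open import Data.List.Relation.Unary.Unique.Propositional using (Unique)
  import Data.List.Relation.Unary.Unique.Propositional.Properties as Uniqueₚ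
  open import Data.List.Relation.Binary.Disjoint.Propositional using (Disjoint)
  open import Data.List.Relation.Unary.Any.Properties using (lookup-index)
  open import Data.List.Relation.Unary.All as All using (All; []; _∷_)
  import Data.List.Relation.Unary.All.Properties as Allₚ
  open import Data.List.Relation.Unary.AllPairs using (AllPairs; []; _∷_)
  open import Data.Rational using (ℚ; 0ℚ; _+_; _*_; -_)
  open import Data.Rational.Properties
  open import Data.Rational.Solver using (module +-*-Solver)
  open import Data.Product using (∃; _×_; _,_; proj₁; proj₂)
  open import Data.Sum using ([_,_]′; inj₁; inj₂)
  open import Relation.Binary.Definitions using (_Respects_)
  open import Relation.Binary.PropositionalEquality
  open +-*-Solver using (solve; _:=_; _:+_; _:*_; :-_)
  open FiniteSum
  open LinearAlgebra

  -- ∂ x y is the coefficient of the face x in the boundary of y.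
  module FilteredHarmonics {T : Set} (∂ : T → T → ℚ) where

    record Window : Set where
      constructor window
      field lower middle upper : List T
    open Window public

    _⊕_ : Window → Window → Window
    A ⊕ B = window (lower A ++ lower B) (middle A ++ middle B) (upper A ++ upper B)

    ∅ : Window
    ∅ = window [] [] []

    ⨁ : List Window → Window
    ⨁ = foldr _⊕_ ∅

    coboundary : T → T → ℚ
    coboundary u s = ∂ s u

    Coclosed : Window → (T → ℚ) → Set
    Coclosed W f = ∀ t → t ∈ lower W → ∑[ s ∈ middle W ] (∂ t s * f s) ≡ 0ℚ

    Closed : Window → (T → ℚ) → Set
    Closed W f = ∀ u → u ∈ upper W → ∑[ s ∈ middle W ] (coboundary u s * f s) ≡ 0ℚ

    Harmonic : Window → (T → ℚ) → Set
    Harmonic W f = Coclosed W f × Closed W f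

    Spans : Window → ∀ {r} → (Fin r → T → ℚ) → Set
    Spans W v = ∀ f → Harmonic W f → ∃ λ w → ∀ x → x ∈ middle W → f x ≡ linComb w v x

    ∂²≡0 : Window → Set
    ∂²≡0 W = ∀ t u → t ∈ lower W → u ∈ upper W → ∑[ s ∈ middle W ] (∂ t s * ∂ s u) ≡ 0ℚ

    NoFaceIn : Window → Window → Set
    NoFaceIn A B = (∀ t s → t ∈ lower A → s ∈ middle B → ∂ t s ≡ 0ℚ)
                 × (∀ s u → s ∈ middle A → u ∈ upper B → ∂ s u ≡ 0ℚ)

    record _⊑_ (W′ W : Window) : Set where
      field
        lower⊆ : ∀ {x} → x ∈ lower W′ → x ∈ lower W
        upper⊆ : ∀ {x} → x ∈ upper W′ → x ∈ upper W
        middle⊇ : ∀ {x} → x ∈ middle W → x ∈ middle W′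
        ∑-middle : ∀ g → ∑ (middle W′) g ≡ ∑ (middle W) g

    Coclosed-resp : ∀ W → Coclosed W Respects _≗_
    Coclosed-resp W f≗g coclosed t t∈ = trans (∑-cong (middle W) (λ s → cong (∂ t s *_) (sym (f≗g s)))) (coclosed t t∈)

    Closed-resp : ∀ W → Closed W Respects _≗_
    Closed-resp W f≗g closed u u∈ = trans (∑-cong (middle W) (λ s → cong (∂ s u *_) (sym (f≗g s)))) (closed u u∈)

    Harmonic-resp : ∀ W → Harmonic W Respects _≗_
    Harmonic-resp W f≗g (coclosed , closed) = Coclosed-resp W f≗g coclosed , Closed-resp W f≗g closed

    Coclosed-linComb : ∀ W {n} (c : Fin n → ℚ) (f : Fin n → T → ℚ) → (∀ i → Coclosed W (f i)) → Coclosed W (linComb c f)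
    Coclosed-linComb W {n} c f coclosed t t∈ = trans (∑-*-linComb (middle W) (∂ t) c f)
      (∑-zero (allFin n) (λ i → trans (cong (c i *_) (coclosed i t t∈)) (*-zeroʳ (c i))))

    Closed-linComb : ∀ W {n} (c : Fin n → ℚ) (f : Fin n → T → ℚ) → (∀ i → Closed W (f i)) → Closed W (linComb c f)
    Closed-linComb W {n} c f closed u u∈ = trans (∑-*-linComb (middle W) (coboundary u) c f)
      (∑-zero (allFin n) (λ i → trans (cong (c i *_) (closed i u u∈)) (*-zeroʳ (c i))))

    Coclosed-minus : ∀ W {f g} → Coclosed W f → Coclosed W g → Coclosed W (λ s → f s + - g s)
    Coclosed-minus W {f} {g} f-coclosed g-coclosed t t∈ = begin
        ∑[ s ∈ middle W ] (∂ t s * (f s + - g s))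
      ≡⟨ ∑-cong (middle W) (λ s → solve 3 (λ d f g → d :* (f :+ :- g) := d :* f :+ :- (d :* g)) refl (∂ t s) (f s) (g s)) ⟩
        ∑[ s ∈ middle W ] (∂ t s * f s + - (∂ t s * g s))
      ≡⟨ ∑-minus (middle W) _ _ ⟩
        ∑[ s ∈ middle W ] (∂ t s * f s) + - ∑[ s ∈ middle W ] (∂ t s * g s)
      ≡⟨ cong₂ (λ a b → a + - b) (f-coclosed t t∈) (g-coclosed t t∈) ⟩
        0ℚ ∎
      where open ≡-Reasoning

    Coclosed-residual : ∀ W {n} {f} (y : Fin n → ℚ) {g : Fin n → T → ℚ} →
      Coclosed W f → (∀ q → Coclosed W (g q)) → Coclosed W (residual f y g)
    Coclosed-residual W y {g} f-coclosed g-coclosed = Coclosed-minus W f-coclosed (Coclosed-linComb W y g g-coclosed)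

    coboundary-coclosed : ∀ W → ∂²≡0 W → ∀ {u} → u ∈ upper W → Coclosed W (coboundary u)
    coboundary-coclosed W ∂∂≡0 u∈ t t∈ = ∂∂≡0 t _ t∈ u∈

    Closed-lookup : ∀ W {f} → (∀ q → ∑[ s ∈ middle W ] (coboundary (lookup (upper W) q) s * f s) ≡ 0ℚ) → Closed W f
    Closed-lookup W {f} ⊥columns u u∈ =
      subst (λ u → ∑[ s ∈ middle W ] (coboundary u s * f s) ≡ 0ℚ) (sym (lookup-index u∈)) (⊥columns (Any.index u∈))

    Closed⇒⊥coboundaries : ∀ W {f} → Closed W f → ∀ {n} (us : Fin n → T) → (∀ q → us q ∈ upper W) →
      ∀ z → ∑[ s ∈ middle W ] (f s * linComb z (coboundary ∘ us) s) ≡ 0ℚ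
    Closed⇒⊥coboundaries W {f} closed {n} us us∈ z = trans (∑-*-linComb (middle W) f z (coboundary ∘ us))
      (∑-zero (allFin n) (λ q → trans (cong (z q *_) (trans (∑-cong (middle W) (λ s → *-comm (f s) (∂ s (us q)))) (closed (us q) (us∈ q))))
                                     (*-zeroʳ (z q))))

    module _ {A B : Window} where

      Coclosed-⊕ˡ : NoFaceIn A B → ∀ {f} → Coclosed (A ⊕ B) f → Coclosed A f
      Coclosed-⊕ˡ (noFace , _) {f} coclosed t t∈ = ∑-++-zeroˡ (middle A) (middle B) _ (coclosed t (∈-++⁺ˡ t∈))
        (∑-zero-on (middle B) (λ s s∈ → trans (cong (_* f s) (noFace t s t∈ s∈)) (*-zeroˡ (f s))))

      Coclosed-⊕ʳ : ∀ {f} → Coclosed (A ⊕ B) f → VanishesOn (middle A) f → Coclosed B f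
      Coclosed-⊕ʳ {f} coclosed f≡0 t t∈ = ∑-++-zeroʳ (middle A) (middle B) _ (coclosed t (∈-++⁺ʳ (lower A) t∈))
        (∑-zero-on (middle A) (λ s s∈ → trans (cong (∂ t s *_) (f≡0 s s∈)) (*-zeroʳ (∂ t s))))

      ∂²≡0-⊕ʳ : NoFaceIn A B → ∂²≡0 (A ⊕ B) → ∂²≡0 B
      ∂²≡0-⊕ʳ (_ , noFace) ∂∂≡0 t u t∈ u∈ =
        ∑-++-zeroʳ (middle A) (middle B) _ (∂∂≡0 t u (∈-++⁺ʳ (lower A) t∈) (∈-++⁺ʳ (upper A) u∈))
          (∑-zero-on (middle A) (λ s s∈ → trans (cong (∂ t s *_) (noFace s u s∈ u∈)) (*-zeroʳ (∂ t s))))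

    module Extension (A B : Window) (noFace : NoFaceIn A B) (∂∂≡0 : ∂²≡0 (A ⊕ B)) where

      private
        nA = length (upper A)
        nB = length (upper B)

        colA : Fin nA → T → ℚ
        colA = coboundary ∘ lookup (upper A)

        colB : Fin nB → T → ℚ
        colB = coboundary ∘ lookup (upper B)

        colA∈ : ∀ q → lookup (upper A) q ∈ upper (A ⊕ B)
        colA∈ q = ∈-++⁺ˡ (∈-lookup {xs = upper A} q)

        colB∈ : ∀ q → lookup (upper B) q ∈ upper (A ⊕ B)
        colB∈ q = ∈-++⁺ʳ (upper A) (∈-lookup {xs = upper B} q)

        colB-vanishes-A : ∀ q → VanishesOn (middle A) (colB q)
        colB-vanishes-A q s s∈ = proj₂ noFace s _ s∈ (∈-lookup {xs = upper B} q)

      coeffA : (T → ℚ) → Fin nA → ℚ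
      coeffA h = proj₁ (InnerProduct.project (middle A) nA colA h)

      stripA : (T → ℚ) → T → ℚ
      stripA h = residual h (coeffA h) colA

      coeffB : (T → ℚ) → Fin nB → ℚ
      coeffB a = proj₁ (InnerProduct.project (middle B) nB colB a)

      stripB : (T → ℚ) → T → ℚ
      stripB a = residual a (coeffB a) colB

      stripA-coclosed : ∀ h → Coclosed (A ⊕ B) h → Coclosed (A ⊕ B) (stripA h)
      stripA-coclosed h h-coclosed =
        Coclosed-residual (A ⊕ B) (coeffA h) h-coclosed (λ q → coboundary-coclosed (A ⊕ B) ∂∂≡0 (colA∈ q))

      stripA-harmonic : ∀ h → Harmonic (A ⊕ B) h → Harmonic A (stripA h)
      stripA-harmonic h (h-coclosed , _) =
        Coclosed-⊕ˡ {A} {B} noFace (stripA-coclosed h h-coclosed) , Closed-lookup A {stripA h} (proj₂ (InnerProduct.project (middle A) nA colA h))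

      stripB-closed : ∀ a → Closed B (stripB a)
      stripB-closed a = Closed-lookup B {stripB a} (proj₂ (InnerProduct.project (middle B) nB colB a))

      module Family {r} (v : Fin r → T → ℚ) (spansA : Spans A v)
                    {n} (h : Fin n → T → ℚ) (h-harmonic : ∀ c → Harmonic (A ⊕ B) (linComb c h)) where

        hᵢ-harmonic : ∀ i → Harmonic (A ⊕ B) (h i)
        hᵢ-harmonic i = Harmonic-resp (A ⊕ B) (λ x → ∑Fin-basis i (λ j → h j x)) (h-harmonic (basis i))

        a : Fin n → T → ℚ
        a i = stripA (h i)

        β : Fin n → T → ℚ
        β i = stripB (a i)

        w : Fin n → Fin r → ℚ
        w i = proj₁ (spansA (a i) (stripA-harmonic (h i) (hᵢ-harmonic i)))

        X : (Fin n → ℚ) → Fin nA → ℚ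
        X c q = ∑[ i < n ] (c i * coeffA (h i) q)

        Y : (Fin n → ℚ) → Fin nB → ℚ
        Y c p = ∑[ i < n ] (c i * coeffB (a i) p)

        linComb-a-vanishes : ∀ c → Solves w c → VanishesOn (middle A) (linComb c a)
        linComb-a-vanishes c sol s s∈ = begin
            linComb c a s
          ≡⟨ ∑-cong (allFin n) (λ i → cong (c i *_) (proj₂ (spansA (a i) (stripA-harmonic (h i) (hᵢ-harmonic i))) s s∈)) ⟩
            linComb c (λ i → linComb (w i) v) s
          ≡⟨ linComb-assoc c w v s ⟩
            ∑[ j < r ] (∑[ i < n ] (c i * w i j) * v j s)
          ≡⟨ ∑-zero (allFin r) (λ j → trans (cong (_* v j s) (sol j)) (*-zeroˡ (v j s))) ⟩
            0ℚ ∎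
          where open ≡-Reasoning

        linComb-β≗ : ∀ c s → linComb c β s ≡ residual (linComb c a) (Y c) colB s
        linComb-β≗ c s = trans (linComb-minus c a (λ i → linComb (coeffB (a i)) colB) s)
          (cong (λ z → linComb c a s + - z) (linComb-assoc c (coeffB ∘ a) colB s))

        linComb-β-harmonic : ∀ c → Solves w c → Harmonic B (linComb c β)
        linComb-β-harmonic c sol =
          Coclosed-resp B (λ s → sym (linComb-β≗ c s))
            (Coclosed-residual B (Y c)
              (Coclosed-⊕ʳ {A} {B} (Coclosed-linComb (A ⊕ B) c a (λ i → stripA-coclosed (h i) (proj₁ (hᵢ-harmonic i)))) (linComb-a-vanishes c sol))
              (λ q → coboundary-coclosed B (∂²≡0-⊕ʳ {A} {B} noFace ∂∂≡0) (∈-lookup {xs = upper B} q))) ,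
          Closed-linComb B c β (λ i → stripB-closed (a i))

        linComb-β-vanishes-A : ∀ c → Solves w c → VanishesOn (middle A) (linComb c β)
        linComb-β-vanishes-A c sol s s∈ = begin
            linComb c β s
          ≡⟨ linComb-β≗ c s ⟩
            linComb c a s + - linComb (Y c) colB s
          ≡⟨ cong₂ (λ p q → p + - q) (linComb-a-vanishes c sol s s∈)
               (∑-zero (allFin nB) (λ q → trans (cong (Y c q *_) (colB-vanishes-A q s s∈)) (*-zeroʳ (Y c q)))) ⟩
            0ℚ ∎
          where open ≡-Reasoning

        linComb-h≗ : ∀ c s → linComb c h s ≡ linComb c β s + (linComb (X c) colA s + linComb (Y c) colB s)
        linComb-h≗ c s = begin
            linComb c h s
          ≡⟨ ∑-cong (allFin n) (λ i → cong (c i *_) (solve 3 (λ h p q → h := (h :+ :- q :+ :- p) :+ (q :+ p)) refl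
                                                        (h i s) (linComb (coeffB (a i)) colB s) (linComb (coeffA (h i)) colA s))) ⟩
            linComb c (λ i s → β i s + (linComb (coeffA (h i)) colA s + linComb (coeffB (a i)) colB s)) s
          ≡⟨ linComb-+ c β (λ i s → linComb (coeffA (h i)) colA s + linComb (coeffB (a i)) colB s) s ⟩
            linComb c β s + linComb c (λ i s → linComb (coeffA (h i)) colA s + linComb (coeffB (a i)) colB s) s
          ≡⟨ cong (linComb c β s +_) (linComb-+ c (λ i → linComb (coeffA (h i)) colA) (λ i → linComb (coeffB (a i)) colB) s) ⟩
            linComb c β s + (linComb c (λ i → linComb (coeffA (h i)) colA) s + linComb c (λ i → linComb (coeffB (a i)) colB) s)
          ≡⟨ cong₂ (λ p q → linComb c β s + (p + q)) (linComb-assoc c (coeffA ∘ h) colA s) (linComb-assoc c (coeffB ∘ a) colB s) ⟩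
            linComb c β s + (linComb (X c) colA s + linComb (Y c) colB s) ∎
          where open ≡-Reasoning

        -- A closed function lying in the span of coboundaries is orthogonal to itself.
        linComb-h-vanishes : ∀ c → VanishesOn (middle (A ⊕ B)) (linComb c β) → VanishesOn (middle (A ⊕ B)) (linComb c h)
        linComb-h-vanishes c β-vanishes = ∑-squares≡0⇒≡0 M H (begin
            ∑[ s ∈ M ] (H s * H s)
          ≡⟨ ∑-cong-on M (λ s s∈ → cong (H s *_) (trans (linComb-h≗ c s)
               (trans (cong (_+ (linComb (X c) colA s + linComb (Y c) colB s)) (β-vanishes s s∈)) (+-identityˡ _)))) ⟩
            ∑[ s ∈ M ] (H s * (linComb (X c) colA s + linComb (Y c) colB s))
          ≡⟨ trans (∑-cong M (λ s → *-distribˡ-+ (H s) _ _)) (∑-+ M _ _) ⟩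
            ∑[ s ∈ M ] (H s * linComb (X c) colA s) + ∑[ s ∈ M ] (H s * linComb (Y c) colB s)
          ≡⟨ cong₂ _+_ (Closed⇒⊥coboundaries (A ⊕ B) H-closed (lookup (upper A)) colA∈ (X c))
                       (Closed⇒⊥coboundaries (A ⊕ B) H-closed (lookup (upper B)) colB∈ (Y c)) ⟩
            0ℚ + 0ℚ
          ≡⟨ +-identityˡ 0ℚ ⟩
            0ℚ ∎)
          where
          open ≡-Reasoning
          M = middle (A ⊕ B)
          H = linComb c h
          H-closed = proj₂ (h-harmonic c)

      Dim≤-harmonic-⊕ : ∀ {r} (v : Fin r → T → ℚ) → Spans A v →
        ∀ {t} → Dim≤ (Harmonic B) (middle B) t → Dim≤ (Harmonic (A ⊕ B)) (middle (A ⊕ B)) (r ℕ.+ t)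
      Dim≤-harmonic-⊕ {r} v spansA dimB n r+t<n h h-harmonic =
        let (c , nontrivial , sol , β-vanishes-B) = Dim≤-constrained r (Harmonic-resp B) dimB n r+t<n w β linComb-β-harmonic
        in c , nontrivial ,
           linComb-h-vanishes c (λ s s∈ → [ linComb-β-vanishes-A c sol s , β-vanishes-B s ]′ (∈-++⁻ (middle A) s∈))
        where open Family v spansA h h-harmonic

    open Extension using (Dim≤-harmonic-⊕)

    NoFaceIn-⨁ : ∀ {A} Ws → All (NoFaceIn A) Ws → NoFaceIn A (⨁ Ws)
    NoFaceIn-⨁ [] [] = (λ _ _ _ ()) , (λ _ _ _ ())
    NoFaceIn-⨁ {A} (W ∷ Ws) (noFace ∷ noFaces) =
      (λ t s t∈ s∈ → [ proj₁ noFace t s t∈ , proj₁ (NoFaceIn-⨁ {A} Ws noFaces) t s t∈ ]′ (∈-++⁻ (middle W) s∈)) ,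
      (λ s u s∈ u∈ → [ proj₂ noFace s u s∈ , proj₂ (NoFaceIn-⨁ {A} Ws noFaces) s u s∈ ]′ (∈-++⁻ (upper W) u∈))

    Dim≤-harmonic-∅ : Dim≤ (Harmonic ∅) [] 0
    Dim≤-harmonic-∅ (suc n) _ _ _ = basis zero , (zero , λ ()) , (λ _ ())

    Dim≤-harmonic-⨁ : ∀ {I : Set} (W : I → Window) (r : I → ℕ) (v : ∀ i → Fin (r i) → T → ℚ) → (∀ i → Spans (W i) (v i)) →
      ∀ is → AllPairs (λ i j → NoFaceIn (W i) (W j)) is → ∂²≡0 (⨁ (map W is)) →
      Dim≤ (Harmonic (⨁ (map W is))) (middle (⨁ (map W is))) (sum (map r is))
    Dim≤-harmonic-⨁ W r v spans [] [] _ = Dim≤-harmonic-∅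
    Dim≤-harmonic-⨁ W r v spans (i ∷ is) (noFaces ∷ noFaces′) ∂∂≡0 =
      Dim≤-harmonic-⊕ (W i) (⨁ (map W is)) noFace ∂∂≡0 (v i) (spans i)
        (Dim≤-harmonic-⨁ W r v spans is noFaces′ (∂²≡0-⊕ʳ {W i} {⨁ (map W is)} noFace ∂∂≡0))
      where
      noFace : NoFaceIn (W i) (⨁ (map W is))
      noFace = NoFaceIn-⨁ {W i} (map W is) (Allₚ.map⁺ noFaces)

    module _ {W′ W : Window} (W′⊑W : W′ ⊑ W) where
      open _⊑_ W′⊑W

      Harmonic-⊑ : ∀ {f} → Harmonic W f → Harmonic W′ f
      Harmonic-⊑ {f} (coclosed , closed) =
        (λ t t∈ → trans (∑-middle (λ s → ∂ t s * f s)) (coclosed t (lower⊆ t∈))) ,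
        (λ u u∈ → trans (∑-middle (λ s → ∂ s u * f s)) (closed u (upper⊆ u∈)))

      ∂²≡0-⊑ : ∂²≡0 W → ∂²≡0 W′
      ∂²≡0-⊑ ∂∂≡0 t u t∈ u∈ = trans (∑-middle (λ s → ∂ t s * ∂ s u)) (∂∂≡0 t u (lower⊆ t∈) (upper⊆ u∈))

      Dim≤-⊑ : ∀ {t} → Dim≤ (Harmonic W′) (middle W′) t → Dim≤ (Harmonic W) (middle W) t
      Dim≤-⊑ = Dim≤-map (λ {f} → Harmonic-⊑ {f}) (λ vanishes x x∈ → vanishes x (middle⊇ x∈))

    module _ {I : Set} (W : I → Window) where

      ∈-⨁⁻ : ∀ (F : Window → List T) → (∀ A B → F (A ⊕ B) ≡ F A ++ F B) → F ∅ ≡ [] →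
        ∀ is {x} → x ∈ F (⨁ (map W is)) → ∃ λ i → i ∈ is × x ∈ F (W i)
      ∈-⨁⁻ F F-⊕ F-∅ [] x∈ with subst (_ ∈_) F-∅ x∈
      ... | ()
      ∈-⨁⁻ F F-⊕ F-∅ (i ∷ is) x∈ with ∈-++⁻ (F (W i)) (subst (_ ∈_) (F-⊕ (W i) (⨁ (map W is))) x∈)
      ... | inj₁ x∈Wᵢ = i , here refl , x∈Wᵢ
      ... | inj₂ x∈rest = let (j , j∈ , x∈Wⱼ) = ∈-⨁⁻ F F-⊕ F-∅ is x∈rest in j , there j∈ , x∈Wⱼ

      ∈-middle-⨁⁺ : ∀ is {i x} → i ∈ is → x ∈ middle (W i) → x ∈ middle (⨁ (map W is))
      ∈-middle-⨁⁺ (i ∷ is) (here refl) x∈ = ∈-++⁺ˡ x∈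
      ∈-middle-⨁⁺ (j ∷ is) (there i∈) x∈ = ∈-++⁺ʳ (middle (W j)) (∈-middle-⨁⁺ is i∈ x∈)

      middle-⨁-unique : (∀ i → Unique (middle (W i))) → ∀ is → AllPairs (λ i j → Disjoint (middle (W i)) (middle (W j))) is →
        Unique (middle (⨁ (map W is)))
      middle-⨁-unique unique [] [] = []
      middle-⨁-unique unique (i ∷ is) (disjoint ∷ disjoints) =
        Uniqueₚ.++⁺ (unique i) (middle-⨁-unique unique is disjoints) disjoint-rest
        where
        disjoint-rest : Disjoint (middle (W i)) (middle (⨁ (map W is)))
        disjoint-rest (x∈Wᵢ , x∈rest) =
          let (j , j∈ , x∈Wⱼ) = ∈-⨁⁻ middle (λ _ _ → refl) refl is x∈rest in All.lookup disjoint j∈ (x∈Wᵢ , x∈Wⱼ)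

module Lists where

  open import Function using (_∘_; id)
  open import Data.Nat as ℕ using (ℕ; zero; suc; _<_)
  open import Data.Nat.Properties using (<-irrefl; <-asym; <-trans)
  open import Data.Fin using (zero; suc)
  open import Data.List using (List; []; _∷_; allFin; map; length; lookup; filter; removeAt)
  open import Data.List.Properties using (map-tabulate; tabulate-lookup; filter-all; filter-reject)
  open import Data.List.Membership.Propositional using (_∈_)
  open import Data.List.Membership.Propositional.Properties using (∈-filter⁺; ∈-filter⁻; ∈-lookup; ∈-map⁺; ∈-map⁻; ∈-concat⁺′; ∈-concat⁻′)
  open import Data.List.Relation.Unary.Any using (here; there; index)
  open import Data.List.Relation.Unary.Any.Properties using (lookup-index)
  open import Data.List.Relation.Unary.All as All using (All; []; _∷_)
  import Data.List.Relation.Unary.All.Properties as Allₚ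
  open import Data.List.Relation.Unary.AllPairs as AllPairs using ([]; _∷_)
  import Data.List.Relation.Unary.AllPairs.Properties as AllPairsₚ
  open import Data.List.Relation.Unary.Unique.Propositional using (Unique)
  import Data.List.Relation.Unary.Unique.Propositional.Properties as Uniqueₚ
  open import Data.List.Relation.Unary.Linked as Linked using (Linked)
  open import Data.List.Relation.Unary.Linked.Properties using (Linked⇒AllPairs)
  open import Data.List.Relation.Binary.Sublist.Propositional using (_⊆_; []; _∷_; _∷ʳ_; ⊆-refl)
  open import Data.List.Relation.Binary.Sublist.Heterogeneous using (minimum)
  open import Data.List.Relation.Binary.Disjoint.Propositional using (Disjoint)
  open import Data.Vec as Vec using (Vec; []; _∷_; replicate)
  import Data.Vec.Properties as Vecₚ
  open import Data.Rational using (ℚ; _+_)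
  open import Data.Rational.Solver using (module +-*-Solver)
  open import Data.Product using (∃; _,_)
  open import Data.Empty using (⊥-elim)
  open import Relation.Binary.PropositionalEquality
  open import Relation.Binary.Definitions using (DecidableEquality)
  open import Relation.Nullary using (yes; no; ¬?)
  open import Relation.Unary using (Pred; Decidable)
  open import Level using (0ℓ)
  open +-*-Solver using (solve; _:=_; _:+_)
  open import Defs using (prodL; power)
  open FiniteSum

  private variable A B : Set

  head< : ∀ {v xs} → Linked _<_ (v ∷ xs) → All (v <_) xs
  head< sorted with Linked⇒AllPairs <-trans sorted
  ... | v<xs ∷ _ = v<xs

  lookup-injective : ∀ {xs : List A} → Unique xs → ∀ {i j} → lookup xs i ≡ lookup xs j → i ≡ j
  lookup-injective {xs = x ∷ xs} (x∉xs ∷ _) {zero} {zero} _ = refl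
  lookup-injective {xs = x ∷ xs} (x∉xs ∷ _) {zero} {suc j} eq = ⊥-elim (All.lookup x∉xs (∈-lookup {xs = xs} j) eq)
  lookup-injective {xs = x ∷ xs} (x∉xs ∷ _) {suc i} {zero} eq = ⊥-elim (All.lookup x∉xs (∈-lookup {xs = xs} i) (sym eq))
  lookup-injective {xs = x ∷ xs} (_ ∷ unique) {suc i} {suc j} eq = cong suc (lookup-injective unique eq)

  map-lookup-allFin : ∀ (xs : List A) → map (lookup xs) (allFin (length xs)) ≡ xs
  map-lookup-allFin xs = trans (map-tabulate id (lookup xs)) (tabulate-lookup xs)

  map-filter : ∀ {P : Pred B 0ℓ} (P? : Decidable P) (f : A → B) (xs : List A) →
    map f (filter (P? ∘ f) xs) ≡ filter P? (map f xs)
  map-filter P? f [] = refl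
  map-filter P? f (x ∷ xs) with P? (f x)
  ... | yes _ = cong (f x ∷_) (map-filter P? f xs)
  ... | no _ = map-filter P? f xs

  ∈⇒lookup : ∀ {xs : List A} {x} → x ∈ xs → ∃ λ i → lookup xs i ≡ x
  ∈⇒lookup x∈xs = index x∈xs , sym (lookup-index x∈xs)

  module _ (_≟_ : DecidableEquality A) where

    private
      remove : A → List A → List A
      remove x = filter (λ z → ¬? (z ≟ x))

      ∑-remove : ∀ {ys : List A} (f : A → ℚ) {x} → Unique ys → x ∈ ys → ∑ ys f ≡ f x + ∑ (remove x ys) f
      ∑-remove {y ∷ ys} f {x} (y∉ys ∷ _) (here refl) = cong (f x +_) (cong (λ l → ∑ l f) (sym (trans
        (filter-reject (λ z → ¬? (z ≟ x)) {y} {ys} (λ x≢x → x≢x refl))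
        (filter-all (λ z → ¬? (z ≟ x)) (All.map (λ y≢z z≡y → y≢z (sym z≡y)) y∉ys)))))
      ∑-remove {y ∷ ys} f {x} (y∉ys ∷ unique) (there x∈ys) with y ≟ x
      ... | yes refl = ⊥-elim (All.lookup y∉ys x∈ys refl)
      ... | no _ = trans (cong (f y +_) (∑-remove f unique x∈ys))
                         (solve 3 (λ a b c → a :+ (b :+ c) := b :+ (a :+ c)) refl (f y) (f x) (∑ (remove x ys) f))

    ∑-same-elements : ∀ (xs ys : List A) (f : A → ℚ) → Unique xs → Unique ys →
      (∀ z → z ∈ xs → z ∈ ys) → (∀ z → z ∈ ys → z ∈ xs) → ∑ xs f ≡ ∑ ys f
    ∑-same-elements [] [] f _ _ _ _ = refl
    ∑-same-elements [] (y ∷ ys) f _ _ _ ys⊆xs with ys⊆xs y (here refl)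
    ... | ()
    ∑-same-elements (x ∷ xs) ys f (x∉xs ∷ unique-xs) unique-ys xs⊆ys ys⊆xs =
      trans (cong (f x +_) (∑-same-elements xs (remove x ys) f unique-xs (Uniqueₚ.filter⁺ _ unique-ys) xs⊆ys′ ys′⊆xs))
            (sym (∑-remove f unique-ys (xs⊆ys x (here refl))))
      where
      xs⊆ys′ : ∀ z → z ∈ xs → z ∈ remove x ys
      xs⊆ys′ z z∈xs = ∈-filter⁺ (λ z → ¬? (z ≟ x)) (xs⊆ys z (there z∈xs)) (λ z≡x → All.lookup x∉xs z∈xs (sym z≡x))
      ys′⊆xs : ∀ z → z ∈ remove x ys → z ∈ xs
      ys′⊆xs z z∈ys′ with ∈-filter⁻ (λ z → ¬? (z ≟ x)) {xs = ys} z∈ys′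
      ... | z∈ys , z≢x with ys⊆xs z z∈ys
      ... | here z≡x = ⊥-elim (z≢x z≡x)
      ... | there z∈xs = z∈xs

  sorted-⊆ : ∀ {xs ys : List ℕ} → Linked _<_ xs → Linked _<_ ys → (∀ v → v ∈ xs → v ∈ ys) → xs ⊆ ys
  sorted-⊆ {[]} {ys} _ _ _ = minimum ys
  sorted-⊆ {v ∷ xs} {[]} _ _ xs⊆ys with xs⊆ys v (here refl)
  ... | ()
  sorted-⊆ {v ∷ xs} {w ∷ ys} sorted-xs sorted-ys xs⊆ys with v ℕ.≟ w
  ... | yes refl = refl ∷ sorted-⊆ (Linked.tail sorted-xs) (Linked.tail sorted-ys) tail⊆
    where
    tail⊆ : ∀ z → z ∈ xs → z ∈ ys
    tail⊆ z z∈xs with xs⊆ys z (there z∈xs)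
    ... | here refl = ⊥-elim (<-irrefl refl (All.lookup (head< sorted-xs) z∈xs))
    ... | there z∈ys = z∈ys
  ... | no v≢w = w ∷ʳ sorted-⊆ sorted-xs (Linked.tail sorted-ys) xs⊆ys′
    where
    v∈ys : v ∈ ys
    v∈ys with xs⊆ys v (here refl)
    ... | here v≡w = ⊥-elim (v≢w v≡w)
    ... | there v∈ys = v∈ys
    xs⊆ys′ : ∀ z → z ∈ v ∷ xs → z ∈ ys
    xs⊆ys′ z z∈ with xs⊆ys z z∈
    ... | there z∈ys = z∈ys
    ... | here refl with z∈
    ...   | here z≡v = ⊥-elim (v≢w (sym z≡v))
    ...   | there z∈xs = ⊥-elim (<-asym (All.lookup (head< sorted-ys) v∈ys) (All.lookup (head< sorted-xs) z∈xs))

  removeAt-⊆ : ∀ (xs : List A) i → removeAt xs i ⊆ xs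
  removeAt-⊆ (x ∷ xs) zero = x ∷ʳ ⊆-refl
  removeAt-⊆ (x ∷ xs) (suc i) = refl ∷ removeAt-⊆ xs i

  ∈-prodL⁺ : ∀ {m} (Xs : Vec (List A) m) (t : Vec A m) → (∀ l → Vec.lookup t l ∈ Vec.lookup Xs l) → t ∈ prodL Xs
  ∈-prodL⁺ [] [] _ = here refl
  ∈-prodL⁺ (X ∷ Xs) (a ∷ t) t∈ =
    ∈-concat⁺′ (∈-map⁺ (a ∷_) (∈-prodL⁺ Xs t (t∈ ∘ suc))) (∈-map⁺ (λ a → map (a ∷_) (prodL Xs)) (t∈ zero))

  ∈-prodL⁻ : ∀ {m} (Xs : Vec (List A) m) (t : Vec A m) → t ∈ prodL Xs → ∀ l → Vec.lookup t l ∈ Vec.lookup Xs l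
  ∈-prodL⁻ (X ∷ Xs) (a ∷ t) t∈ l with ∈-concat⁻′ (map (λ a → map (a ∷_) (prodL Xs)) X) t∈
  ... | _ , t∈₁ , t∈₂ with ∈-map⁻ (λ a → map (a ∷_) (prodL Xs)) t∈₂
  ... | _ , a∈X , refl with ∈-map⁻ (_ ∷_) t∈₁
  ... | _ , t∈Xs , refl with l
  ... | zero = a∈X
  ... | suc l = ∈-prodL⁻ Xs _ t∈Xs l

  prodL-unique : ∀ {m} (Xs : Vec (List A) m) → (∀ l → Unique (Vec.lookup Xs l)) → Unique (prodL Xs)
  prodL-unique [] _ = [] ∷ []
  prodL-unique (X ∷ Xs) unique =
    Uniqueₚ.concat⁺ (Allₚ.map⁺ (All.tabulate (λ _ → Uniqueₚ.map⁺ Vecₚ.∷-injectiveʳ (prodL-unique Xs (unique ∘ suc)))))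
                   (AllPairsₚ.map⁺ (AllPairs.map disjoint (unique zero)))
    where
    disjoint : ∀ {a b} → a ≢ b → Disjoint (map (a ∷_) (prodL Xs)) (map (b ∷_) (prodL Xs))
    disjoint a≢b (t∈₁ , t∈₂) with ∈-map⁻ (_ ∷_) t∈₁ | ∈-map⁻ (_ ∷_) t∈₂
    ... | _ , _ , refl | _ , _ , eq = a≢b (Vecₚ.∷-injectiveˡ eq)

  ∈-power⁺ : ∀ (X : List A) m (t : Vec A m) → (∀ l → Vec.lookup t l ∈ X) → t ∈ power X m
  ∈-power⁺ X m t t∈ = ∈-prodL⁺ (replicate m X) t (λ l → subst (Vec.lookup t l ∈_) (sym (Vecₚ.lookup-replicate l X)) (t∈ l))

  ∈-power⁻ : ∀ (X : List A) m (t : Vec A m) → t ∈ power X m → ∀ l → Vec.lookup t l ∈ X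
  ∈-power⁻ X m t t∈ l = subst (Vec.lookup t l ∈_) (Vecₚ.lookup-replicate l X) (∈-prodL⁻ (replicate m X) t t∈ l)

  power-unique : ∀ (X : List A) m → Unique X → Unique (power X m)
  power-unique X m unique = prodL-unique (replicate m X) (λ l → subst Unique (sym (Vecₚ.lookup-replicate l X)) unique)

  ⊆-nonempty : ∀ {xs ys : List A} → xs ⊆ ys → xs ≢ [] → ys ≢ []
  ⊆-nonempty xs⊆[] xs≢[] refl = xs≢[] (⊆[]⇒≡[] xs⊆[])
    where
    ⊆[]⇒≡[] : ∀ {xs : List A} → xs ⊆ [] → xs ≡ []
    ⊆[]⇒≡[] [] = refl

module TupleBoundary where

  open import Function using (_∘_)
  open import Data.Nat as ℕ using (ℕ; zero; suc)
  open import Data.Nat.Properties using (+-assoc)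
  open import Data.Fin using (Fin; zero; suc; toℕ)
  open import Data.List using (List; []; _∷_; length; allFin; removeAt)
  open import Data.List.Properties using (length-removeAt′)
  open import Data.Vec using (Vec; []; _∷_; lookup)
  open import Data.Rational using (ℚ; 0ℚ; 1ℚ; _+_; _*_; -_)
  open import Data.Rational.Properties hiding (+-assoc)
  open import Data.Rational.Solver using (module +-*-Solver)
  open import Relation.Binary.PropositionalEquality
  open import Relation.Nullary using (Dec; yes; no)
  open import Data.Empty using (⊥-elim)
  open +-*-Solver using (solve; _:=_; _:+_; _:*_; :-_; con)
  open import Defs
  open FiniteSum

  sign-+ : ∀ a b → sign (a ℕ.+ b) ≡ sign a * sign b
  sign-+ zero b = sym (*-identityˡ (sign b))
  sign-+ (suc a) b = trans (cong -_ (sign-+ a b)) (neg-distribˡ-* (sign a) (sign b))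

  dim-removeAt : ∀ x i → removeAt x i ≢ [] → dim x ≡ suc (dim (removeAt x i))
  dim-removeAt x i nonempty = lemma (removeAt x i) (length-removeAt′ x i) nonempty
    where
    lemma : ∀ r → length x ≡ suc (length r) → r ≢ [] → length x ℕ.∸ 1 ≡ suc (length r ℕ.∸ 1)
    lemma [] _ r≢[] = ⊥-elim (r≢[] refl)
    lemma (_ ∷ _) eq _ rewrite eq = refl

  module _ {A : Set} where

    ∂ˢ : (List A → ℚ) → List A → ℚ
    ∂ˢ F x = ∑[ i < length x ] (sign (toℕ i) * F (removeAt x i))

    ∂ˢ-cong : ∀ {F G : List A → ℚ} → (∀ y → F y ≡ G y) → ∀ x → ∂ˢ F x ≡ ∂ˢ G x
    ∂ˢ-cong F≗G x = ∑-cong (allFin (length x)) (λ i → cong (sign (toℕ i) *_) (F≗G (removeAt x i)))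

    ∂ˢ-+ : ∀ (F G : List A → ℚ) x → ∂ˢ (λ y → F y + G y) x ≡ ∂ˢ F x + ∂ˢ G x
    ∂ˢ-+ F G x = trans (∑-cong (allFin (length x)) (λ i → *-distribˡ-+ (sign (toℕ i)) _ _)) (∑-+ (allFin (length x)) _ _)

    ∂ˢ-neg : ∀ (F : List A → ℚ) x → ∂ˢ (λ y → - F y) x ≡ - ∂ˢ F x
    ∂ˢ-neg F x = trans (∑-cong (allFin (length x)) (λ i → sym (neg-distribʳ-* (sign (toℕ i)) _))) (∑-neg (allFin (length x)) _)

    ∂ˢ-∷ : ∀ (F : List A → ℚ) v x → ∂ˢ F (v ∷ x) ≡ F x + - ∂ˢ (λ y → F (v ∷ y)) x
    ∂ˢ-∷ F v x = begin
        ∂ˢ F (v ∷ x)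
      ≡⟨ ∑Fin-suc (length x) (λ i → sign (toℕ i) * F (removeAt (v ∷ x) i)) ⟩
        1ℚ * F x + ∑[ i < length x ] (- sign (toℕ i) * F (v ∷ removeAt x i))
      ≡⟨ cong₂ _+_ (*-identityˡ (F x)) (trans (∑-cong (allFin (length x)) (λ i → sym (neg-distribˡ-* (sign (toℕ i)) _)))
                                               (∑-neg (allFin (length x)) _)) ⟩
        F x + - ∂ˢ (λ y → F (v ∷ y)) x ∎
      where open ≡-Reasoning

    -- Removing v first and then the i-th vertex cancels removing the i-th vertex and then v.
    ∂ˢ∘∂ˢ≡0 : ∀ (F : List A → ℚ) x → ∂ˢ (∂ˢ F) x ≡ 0ℚ
    ∂ˢ∘∂ˢ≡0 F [] = refl
    ∂ˢ∘∂ˢ≡0 F (v ∷ x) = begin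
        ∂ˢ (∂ˢ F) (v ∷ x)
      ≡⟨ ∂ˢ-∷ (∂ˢ F) v x ⟩
        ∂ˢ F x + - ∂ˢ (λ y → ∂ˢ F (v ∷ y)) x
      ≡⟨ cong (λ z → ∂ˢ F x + - z) (∂ˢ-cong (∂ˢ-∷ F v) x) ⟩
        ∂ˢ F x + - ∂ˢ (λ y → F y + - ∂ˢ (λ z → F (v ∷ z)) y) x
      ≡⟨ cong (λ z → ∂ˢ F x + - z) (trans (∂ˢ-+ F (λ y → - ∂ˢ (λ z → F (v ∷ z)) y) x)
                                          (cong (∂ˢ F x +_) (∂ˢ-neg (∂ˢ (λ z → F (v ∷ z))) x))) ⟩
        ∂ˢ F x + - (∂ˢ F x + - ∂ˢ (∂ˢ (λ z → F (v ∷ z))) x)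
      ≡⟨ cong (λ z → ∂ˢ F x + - (∂ˢ F x + - z)) (∂ˢ∘∂ˢ≡0 (λ z → F (v ∷ z)) x) ⟩
        ∂ˢ F x + - (∂ˢ F x + - 0ℚ)
      ≡⟨ solve 1 (λ a → a :+ :- (a :+ :- con 0ℚ) := con 0ℚ) refl (∂ˢ F x) ⟩
        0ℚ ∎
      where open ≡-Reasoning

  ∂ᵗ : ∀ {m} → (Vec Simplex m → ℚ) → Vec Simplex m → ℚ
  ∂ᵗ {m} F t = ∑[ l < m ] ∑[ i < length (lookup t l) ] (sign (preDim t l ℕ.+ toℕ i) * F (face t l i))

  ∂ᵗ-cong : ∀ {m} {F G : Vec Simplex m → ℚ} → (∀ s → F s ≡ G s) → ∀ t → ∂ᵗ F t ≡ ∂ᵗ G t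
  ∂ᵗ-cong {m} F≗G t = ∑-cong (allFin m) (λ l → ∑-cong (allFin (length (lookup t l))) (λ i → cong (sign (preDim t l ℕ.+ toℕ i) *_) (F≗G (face t l i))))

  ∂ᵗ-+ : ∀ {m} (F G : Vec Simplex m → ℚ) t → ∂ᵗ (λ s → F s + G s) t ≡ ∂ᵗ F t + ∂ᵗ G t
  ∂ᵗ-+ {m} F G t = trans
    (∑-cong (allFin m) (λ l → trans (∑-cong (allFin (length (lookup t l))) (λ i → *-distribˡ-+ (σ l i) (F (face t l i)) (G (face t l i))))
                                    (∑-+ (allFin (length (lookup t l))) (λ i → σ l i * F (face t l i)) (λ i → σ l i * G (face t l i)))))
    (∑-+ (allFin m) (λ l → ∑[ i < length (lookup t l) ] (σ l i * F (face t l i))) (λ l → ∑[ i < length (lookup t l) ] (σ l i * G (face t l i))))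
    where
    σ : ∀ l → Fin (length (lookup t l)) → ℚ
    σ l i = sign (preDim t l ℕ.+ toℕ i)

  ∂ᵗ-*ˡ : ∀ {m} (k : ℚ) (F : Vec Simplex m → ℚ) t → ∂ᵗ (λ s → k * F s) t ≡ k * ∂ᵗ F t
  ∂ᵗ-*ˡ {m} k F t = trans
    (∑-cong (allFin m) (λ l → trans (∑-cong (allFin (length (lookup t l)))
                                              (λ i → solve 3 (λ s k f → s :* (k :* f) := k :* (s :* f)) refl (σ l i) k (F (face t l i))))
                                    (∑-*ˡ (allFin (length (lookup t l))) k (λ i → σ l i * F (face t l i)))))
    (∑-*ˡ (allFin m) k (λ l → ∑[ i < length (lookup t l) ] (σ l i * F (face t l i))))
    where
    σ : ∀ l → Fin (length (lookup t l)) → ℚ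
    σ l i = sign (preDim t l ℕ.+ toℕ i)

  ∂ᵗ-∷ : ∀ {m} (F : Vec Simplex (suc m) → ℚ) x t →
    ∂ᵗ F (x ∷ t) ≡ ∂ˢ (λ y → F (y ∷ t)) x + sign (dim x) * ∂ᵗ (λ s → F (x ∷ s)) t
  ∂ᵗ-∷ {m} F x t = trans (∑Fin-suc m row) (cong (∂ˢ (λ y → F (y ∷ t)) x +_) (begin
      ∑[ l < m ] ∑[ i < length (lookup t l) ] (sign ((dim x ℕ.+ preDim t l) ℕ.+ toℕ i) * F (x ∷ face t l i))
    ≡⟨ ∑-cong (allFin m) (λ l → ∑-cong (allFin (length (lookup t l))) (λ i → begin
          sign ((dim x ℕ.+ preDim t l) ℕ.+ toℕ i) * F (x ∷ face t l i)
        ≡⟨ cong (_* F (x ∷ face t l i)) (trans (cong sign (+-assoc (dim x) (preDim t l) (toℕ i))) (sign-+ (dim x) _)) ⟩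
          sign (dim x) * sign (preDim t l ℕ.+ toℕ i) * F (x ∷ face t l i)
        ≡⟨ *-assoc (sign (dim x)) _ _ ⟩
          sign (dim x) * (sign (preDim t l ℕ.+ toℕ i) * F (x ∷ face t l i)) ∎)) ⟩
      ∑[ l < m ] ∑[ i < length (lookup t l) ] (sign (dim x) * (sign (preDim t l ℕ.+ toℕ i) * F (x ∷ face t l i)))
    ≡⟨ trans (∑-cong (allFin m) (λ l → ∑-*ˡ (allFin (length (lookup t l))) (sign (dim x)) (λ i → sign (preDim t l ℕ.+ toℕ i) * F (x ∷ face t l i))))
             (∑-*ˡ (allFin m) (sign (dim x)) (λ l → ∑[ i < length (lookup t l) ] (sign (preDim t l ℕ.+ toℕ i) * F (x ∷ face t l i)))) ⟩
      sign (dim x) * ∂ᵗ (λ s → F (x ∷ s)) t ∎))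
    where
    open ≡-Reasoning
    row : Fin (suc m) → ℚ
    row l = ∑[ i < length (lookup (x ∷ t) l) ] (sign (preDim (x ∷ t) l ℕ.+ toℕ i) * F (face (x ∷ t) l i))

  ∂ˢ-∂ᵗ-comm : ∀ {m} (F : Simplex → Vec Simplex m → ℚ) x t →
    ∂ˢ (λ y → ∂ᵗ (F y) t) x ≡ ∂ᵗ (λ s → ∂ˢ (λ y → F y s) x) t
  ∂ˢ-∂ᵗ-comm {m} F x t = begin
      ∑[ i < length x ] (sign (toℕ i) * ∑[ l < m ] ∑[ j < len l ] (σ l j * F (removeAt x i) (face t l j)))
    ≡⟨ ∑-cong (allFin (length x)) (λ i → trans (sym (∑-*ˡ (allFin m) (sign (toℕ i)) _))
                                                (∑-cong (allFin m) (λ l → sym (∑-*ˡ (allFin (len l)) (sign (toℕ i)) _)))) ⟩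
      ∑[ i < length x ] ∑[ l < m ] ∑[ j < len l ] (sign (toℕ i) * (σ l j * F (removeAt x i) (face t l j)))
    ≡⟨ ∑-comm (allFin (length x)) (allFin m) _ ⟩
      ∑[ l < m ] ∑[ i < length x ] ∑[ j < len l ] (sign (toℕ i) * (σ l j * F (removeAt x i) (face t l j)))
    ≡⟨ ∑-cong (allFin m) (λ l → ∑-comm (allFin (length x)) (allFin (len l)) _) ⟩
      ∑[ l < m ] ∑[ j < len l ] ∑[ i < length x ] (sign (toℕ i) * (σ l j * F (removeAt x i) (face t l j)))
    ≡⟨ ∑-cong (allFin m) (λ l → ∑-cong (allFin (len l)) (λ j →
         trans (∑-cong (allFin (length x)) (λ i → solve 3 (λ a b c → a :* (b :* c) := b :* (a :* c)) refl (sign (toℕ i)) (σ l j) _))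
               (∑-*ˡ (allFin (length x)) (σ l j) _))) ⟩
      ∑[ l < m ] ∑[ j < len l ] (σ l j * ∑[ i < length x ] (sign (toℕ i) * F (removeAt x i) (face t l j))) ∎
    where
    open ≡-Reasoning
    len : Fin m → ℕ
    len l = length (lookup t l)
    σ : ∀ l → Fin (len l) → ℚ
    σ l j = sign (preDim t l ℕ.+ toℕ j)

  -- dim [] = dim [ v ] = 0 (truncated subtraction), so the sign flip needs G [] ≡ 0.
  ∂ˢ-sign-dim : ∀ (G : Simplex → ℚ) → G [] ≡ 0ℚ → ∀ x → ∂ˢ (λ y → sign (dim y) * G y) x ≡ - (sign (dim x) * ∂ˢ G x)
  ∂ˢ-sign-dim G G[]≡0 x = begin
      ∑[ i < length x ] (sign (toℕ i) * (sign (dim (removeAt x i)) * G (removeAt x i)))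
    ≡⟨ ∑-cong (allFin (length x)) (λ i → term i (removeAt x i ≟S [])) ⟩
      ∑[ i < length x ] (- (sign (dim x) * (sign (toℕ i) * G (removeAt x i))))
    ≡⟨ trans (∑-neg (allFin (length x)) _) (cong -_ (∑-*ˡ (allFin (length x)) (sign (dim x)) _)) ⟩
      - (sign (dim x) * ∂ˢ G x) ∎
    where
    open ≡-Reasoning
    term : ∀ i → Dec (removeAt x i ≡ []) →
      sign (toℕ i) * (sign (dim (removeAt x i)) * G (removeAt x i)) ≡ - (sign (dim x) * (sign (toℕ i) * G (removeAt x i)))
    term i (yes xᵢ≡[]) rewrite xᵢ≡[] | G[]≡0 =
      solve 3 (λ a b c → a :* (b :* con 0ℚ) := :- (c :* (a :* con 0ℚ))) refl (sign (toℕ i)) (sign 0) (sign (dim x))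
    term i (no xᵢ≢[]) rewrite dim-removeAt x i xᵢ≢[] =
      solve 3 (λ a b g → a :* (b :* g) := :- ((:- b) :* (a :* g))) refl (sign (toℕ i)) (sign (dim (removeAt x i))) (G (removeAt x i))

  VanishesOnEmptyEntries : ∀ {m} → (Vec Simplex m → ℚ) → Set
  VanishesOnEmptyEntries F = ∀ t l → lookup t l ≡ [] → F t ≡ 0ℚ

  ∂ᵗ∘∂ᵗ≡0 : ∀ {m} (F : Vec Simplex m → ℚ) → VanishesOnEmptyEntries F → ∀ t → ∂ᵗ (∂ᵗ F) t ≡ 0ℚ
  ∂ᵗ∘∂ᵗ≡0 F F-vanishes [] = refl
  ∂ᵗ∘∂ᵗ≡0 {suc m} F F-vanishes (x ∷ t) = begin
      ∂ᵗ (∂ᵗ F) (x ∷ t)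
    ≡⟨ ∂ᵗ-∷ (∂ᵗ F) x t ⟩
      ∂ˢ (λ y → ∂ᵗ F (y ∷ t)) x + sign (dim x) * ∂ᵗ (λ s → ∂ᵗ F (x ∷ s)) t
    ≡⟨ cong₂ (λ p q → p + sign (dim x) * q) (∂ˢ-cong (λ y → ∂ᵗ-∷ F y t) x) (∂ᵗ-cong (λ s → ∂ᵗ-∷ F x s) t) ⟩
      ∂ˢ (λ y → ∂ˢ (Fˢ t) y + sign (dim y) * G y) x
        + sign (dim x) * ∂ᵗ (λ s → ∂ˢ (Fˢ s) x + sign (dim x) * ∂ᵗ Fᵗ s) t
    ≡⟨ cong₂ (λ p q → p + sign (dim x) * q) (∂ˢ-+ (∂ˢ (Fˢ t)) (λ y → sign (dim y) * G y) x)
         (trans (∂ᵗ-+ (λ s → ∂ˢ (Fˢ s) x) (λ s → sign (dim x) * ∂ᵗ Fᵗ s) t)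
                (cong (∂ᵗ (λ s → ∂ˢ (Fˢ s) x) t +_) (∂ᵗ-*ˡ (sign (dim x)) (∂ᵗ Fᵗ) t))) ⟩
      (∂ˢ (∂ˢ (Fˢ t)) x + ∂ˢ (λ y → sign (dim y) * G y) x)
        + sign (dim x) * (∂ᵗ (λ s → ∂ˢ (Fˢ s) x) t + sign (dim x) * ∂ᵗ (∂ᵗ Fᵗ) t)
    ≡⟨ cong₂ (λ p q → p + sign (dim x) * q)
         (cong₂ _+_ (∂ˢ∘∂ˢ≡0 (Fˢ t) x) (∂ˢ-sign-dim G G[]≡0 x))
         (cong₂ (λ p q → p + sign (dim x) * q) (sym (∂ˢ-∂ᵗ-comm (λ y s → F (y ∷ s)) x t))
                (∂ᵗ∘∂ᵗ≡0 Fᵗ (λ s l sₗ≡[] → F-vanishes (x ∷ s) (suc l) sₗ≡[]) t)) ⟩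
      (0ℚ + - (sign (dim x) * ∂ˢ G x)) + sign (dim x) * (∂ˢ G x + sign (dim x) * 0ℚ)
    ≡⟨ solve 2 (λ s g → (con 0ℚ :+ :- (s :* g)) :+ s :* (g :+ s :* con 0ℚ) := con 0ℚ) refl (sign (dim x)) (∂ˢ G x) ⟩
      0ℚ ∎
    where
    open ≡-Reasoning
    Fˢ : Vec Simplex m → Simplex → ℚ
    Fˢ s y = F (y ∷ s)
    Fᵗ : Vec Simplex m → ℚ
    Fᵗ s = F (x ∷ s)
    G : Simplex → ℚ
    G y = ∂ᵗ (λ s → F (y ∷ s)) t
    G[]≡0 : G [] ≡ 0ℚ
    G[]≡0 = ∑-zero (allFin m) (λ l → ∑-zero (allFin (length (lookup t l)))
              (λ i → trans (cong (sign (preDim t l ℕ.+ toℕ i) *_) (F-vanishes ([] ∷ face t l i) zero refl)) (*-zeroʳ (sign (preDim t l ℕ.+ toℕ i)))))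

module Tuples where

  open import Function using (_∘_)
  open import Data.Nat as ℕ using (ℕ; zero; suc; _<_)
  open import Data.Nat.Properties using (+-suc; <-trans)
  open import Data.Fin using (Fin; zero; suc; toℕ)
  open import Data.Fin.Properties using (any?)
  open import Data.List using (List; []; _∷_; allFin; map; length)
  open import Data.List.Membership.Propositional using (_∈_)
  open import Data.List.Membership.Propositional.Properties using (∈-filter⁻)
  import Data.List.Membership.DecPropositional as DecMembership
  open import Data.List.Relation.Unary.Any using (here; there)
  import Data.List.Relation.Unary.All as All
  open import Data.List.Relation.Unary.AllPairs using (_∷_)
  open import Data.List.Relation.Unary.Unique.Propositional using (Unique)
  open import Data.List.Relation.Unary.Linked using (Linked)
  import Data.List.Relation.Unary.Linked.Properties as Linkedₚ
  open import Data.List.Relation.Binary.Sublist.Propositional using (_⊆_; []; ⊆-refl; lookup)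
  import Data.List.Relation.Binary.Sublist.Propositional.Properties as Sublistₚ
  open import Data.Vec as Vec using (Vec; []; _∷_)
  import Data.Vec.Properties as Vecₚ
  open import Data.Rational using (ℚ; 0ℚ; 1ℚ; _+_; _*_)
  open import Data.Rational.Properties using (*-zeroˡ; *-zeroʳ; *-identityˡ; +-identityʳ; +-identityˡ; *-assoc; _≟_)
  open import Data.Product using (∃₂; _,_; proj₁; proj₂)
  open import Data.Empty using (⊥-elim)
  open import Relation.Binary.PropositionalEquality
  open import Relation.Nullary using (Dec; yes; no)
  open import Defs
  open FiniteSum
  open Lists using (sorted-⊆; removeAt-⊆)
  open TupleBoundary

  open DecMembership ℕ._≟_ using () renaming (_∈?_ to _∈ℕ?_)

  Tuple : ℕ → Set
  Tuple m = Vec Simplex m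

  -- Defs.deg takes the list Λ as a module parameter it never uses.
  degree : ∀ {m} → Tuple m → ℕ
  degree = deg []

  NonemptyEntries : ∀ {m} → Tuple m → Set
  NonemptyEntries t = ∀ l → Vec.lookup t l ≢ []

  δ-≡ : ∀ {m} {t s : Tuple m} → t ≡ s → δ t s ≡ 1ℚ
  δ-≡ {t = t} {s} t≡s with Vecₚ.≡-dec _≟S_ t s
  ... | yes _ = refl
  ... | no t≢s = ⊥-elim (t≢s t≡s)

  δ-≢ : ∀ {m} {t s : Tuple m} → t ≢ s → δ t s ≡ 0ℚ
  δ-≢ {t = t} {s} t≢s with Vecₚ.≡-dec _≟S_ t s
  ... | yes t≡s = ⊥-elim (t≢s t≡s)
  ... | no _ = refl

  sumℚ-map : ∀ {A : Set} (f : A → ℚ) (xs : List A) → sumℚ (map f xs) ≡ ∑ xs f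
  sumℚ-map f [] = refl
  sumℚ-map f (x ∷ xs) = cong (f x +_) (sumℚ-map f xs)

  dEntry≡∂ᵗδ : ∀ {m} (t s : Tuple m) → dEntry t s ≡ ∂ᵗ (λ r → δ r s) t
  dEntry≡∂ᵗδ {m} t s = trans (sumℚ-map _ (allFin m)) (∑-cong (allFin m) (λ l → sumℚ-map _ (allFin (length (Vec.lookup t l)))))

  dEntry≢0⇒face : ∀ {m} (t s : Tuple m) → dEntry t s ≢ 0ℚ → ∃₂ λ l i → face t l i ≡ s
  dEntry≢0⇒face {m} t s dEntry≢0 with any? (λ l → any? (λ i → Vecₚ.≡-dec _≟S_ (face t l i) s))
  ... | yes (l , i , eq) = l , i , eq
  ... | no no-face = ⊥-elim (dEntry≢0 (trans (dEntry≡∂ᵗδ t s)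
        (∑-zero (allFin m) (λ l → ∑-zero (allFin (length (Vec.lookup t l)))
          (λ i → trans (cong (sign (preDim t l ℕ.+ toℕ i) *_) (δ-≢ (λ eq → no-face (l , i , eq)))) (*-zeroʳ (sign (preDim t l ℕ.+ toℕ i))))))))

  face-⊆ : ∀ {m} (t : Tuple m) l i l′ → Vec.lookup (face t l i) l′ ⊆ Vec.lookup t l′
  face-⊆ (x ∷ t) zero i zero = removeAt-⊆ x i
  face-⊆ (x ∷ t) zero i (suc l′) = ⊆-refl
  face-⊆ (x ∷ t) (suc l) i zero = ⊆-refl
  face-⊆ (x ∷ t) (suc l) i (suc l′) = face-⊆ t l i l′

  dEntry≢0⇒⊆ : ∀ {m} (t s : Tuple m) → dEntry t s ≢ 0ℚ → ∀ l → Vec.lookup s l ⊆ Vec.lookup t l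
  dEntry≢0⇒⊆ t s dEntry≢0 l with dEntry≢0⇒face t s dEntry≢0
  ... | l′ , i , refl = face-⊆ t l′ i l

  degree-face : ∀ {m} (t : Tuple m) l i → NonemptyEntries (face t l i) → degree t ≡ suc (degree (face t l i))
  degree-face (x ∷ t) zero i nonempty = cong (ℕ._+ degree t) (dim-removeAt x i (nonempty zero))
  degree-face (x ∷ t) (suc l) i nonempty = trans (cong (dim x ℕ.+_) (degree-face t l i (nonempty ∘ suc))) (+-suc (dim x) _)

  dEntry≢0⇒degree : ∀ {m} (t s : Tuple m) → NonemptyEntries s → dEntry t s ≢ 0ℚ → degree t ≡ suc (degree s)
  dEntry≢0⇒degree t s nonempty dEntry≢0 with dEntry≢0⇒face t s dEntry≢0
  ... | l , i , refl = degree-face t l i nonempty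

  δ-vanishesOnEmptyEntries : ∀ {m} {s : Tuple m} → NonemptyEntries s → VanishesOnEmptyEntries (λ r → δ r s)
  δ-vanishesOnEmptyEntries nonempty r l rₗ≡[] = δ-≢ (λ r≡s → nonempty l (trans (sym (cong (λ r → Vec.lookup r l) r≡s)) rₗ≡[]))

  ∑-δ : ∀ {m} (L : List (Tuple m)) (f : Tuple m) (G : Tuple m → ℚ) → Unique L → (G f ≢ 0ℚ → f ∈ L) →
    ∑[ s ∈ L ] (δ f s * G s) ≡ G f
  ∑-δ L f G unique f∈L with G f ≟ 0ℚ
  ... | yes Gf≡0 = trans (∑-zero L (λ s → term s (Vecₚ.≡-dec _≟S_ f s))) (sym Gf≡0)
    where
    term : ∀ s → Dec (f ≡ s) → δ f s * G s ≡ 0ℚ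
    term s (yes refl) = trans (cong (δ f f *_) Gf≡0) (*-zeroʳ (δ f f))
    term s (no f≢s) = trans (cong (_* G s) (δ-≢ f≢s)) (*-zeroˡ (G s))
  ... | no Gf≢0 = ∑-δ-∈ L unique (f∈L Gf≢0)
    where
    ∑-δ-∈ : ∀ L → Unique L → f ∈ L → ∑[ s ∈ L ] (δ f s * G s) ≡ G f
    ∑-δ-∈ (s ∷ L) (s∉L ∷ unique) (here refl) =
      trans (cong₂ _+_ (trans (cong (_* G f) (δ-≡ {t = f} refl)) (*-identityˡ (G f)))
                       (∑-zero-on L (λ s′ s′∈L → trans (cong (_* G s′) (δ-≢ (All.lookup s∉L s′∈L))) (*-zeroˡ (G s′)))))
            (+-identityʳ (G f))
    ∑-δ-∈ (s ∷ L) (s∉L ∷ unique) (there f∈L) =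
      trans (cong (_+ ∑[ s′ ∈ L ] (δ f s′ * G s′)) (trans (cong (_* G s) (δ-≢ (λ f≡s → All.lookup s∉L f∈L (sym f≡s)))) (*-zeroˡ (G s))))
            (trans (+-identityˡ _) (∑-δ-∈ L unique f∈L))

  ∑-dEntry : ∀ {m} (L : List (Tuple m)) (u : Tuple m) (G : Tuple m → ℚ) → Unique L →
    (∀ l i → G (face u l i) ≢ 0ℚ → face u l i ∈ L) → ∑[ s ∈ L ] (dEntry u s * G s) ≡ ∂ᵗ G u
  ∑-dEntry {m} L u G unique faces∈L = begin
      ∑[ s ∈ L ] (dEntry u s * G s)
    ≡⟨ ∑-cong L (λ s → cong (_* G s) (dEntry≡∂ᵗδ u s)) ⟩
      ∑[ s ∈ L ] (∑[ l < m ] ∑[ i < len l ] (σ l i * δ (face u l i) s) * G s)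
    ≡⟨ ∑-cong L (λ s → trans (sym (∑-*ʳ (allFin m) (G s) (λ l → ∑[ i < len l ] (σ l i * δ (face u l i) s))))
                             (∑-cong (allFin m) (λ l → trans (sym (∑-*ʳ (allFin (len l)) (G s) (λ i → σ l i * δ (face u l i) s)))
                                                             (∑-cong (allFin (len l)) (λ i → *-assoc (σ l i) (δ (face u l i) s) (G s)))))) ⟩
      ∑[ s ∈ L ] ∑[ l < m ] ∑[ i < len l ] (σ l i * (δ (face u l i) s * G s))
    ≡⟨ ∑-comm L (allFin m) (λ s l → ∑[ i < len l ] (σ l i * (δ (face u l i) s * G s))) ⟩
      ∑[ l < m ] ∑[ s ∈ L ] ∑[ i < len l ] (σ l i * (δ (face u l i) s * G s))
    ≡⟨ ∑-cong (allFin m) (λ l → ∑-comm L (allFin (len l)) (λ s i → σ l i * (δ (face u l i) s * G s))) ⟩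
      ∑[ l < m ] ∑[ i < len l ] ∑[ s ∈ L ] (σ l i * (δ (face u l i) s * G s))
    ≡⟨ ∑-cong (allFin m) (λ l → ∑-cong (allFin (len l)) (λ i →
         trans (∑-*ˡ L (σ l i) (λ s → δ (face u l i) s * G s)) (cong (σ l i *_) (∑-δ L (face u l i) G unique (faces∈L l i))))) ⟩
      ∂ᵗ G u ∎
    where
    open ≡-Reasoning
    len : Fin m → ℕ
    len l = length (Vec.lookup u l)
    σ : ∀ l → Fin (len l) → ℚ
    σ l i = sign (preDim u l ℕ.+ toℕ i)

  inter-mono : ∀ {x′ x y′ y : Simplex} → x′ ⊆ x → y′ ⊆ y → inter x′ y′ ⊆ inter x y
  inter-mono {y′ = y′} {y = y} x′⊆x y′⊆y =
    Sublistₚ.filter⁺ (λ v → v ∈ℕ? y′) (λ v → v ∈ℕ? y) (λ { refl v∈y′ → lookup y′⊆y v∈y′ }) x′⊆x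

  ⋂-mono : ∀ {m} (s t : Tuple m) → (∀ l → Vec.lookup s l ⊆ Vec.lookup t l) → ⋂ s ⊆ ⋂ t
  ⋂-mono [] [] _ = []
  ⋂-mono (x ∷ []) (y ∷ []) s⊆t = s⊆t zero
  ⋂-mono (x ∷ x′ ∷ s) (y ∷ y′ ∷ t) s⊆t = inter-mono (s⊆t zero) (⋂-mono (x′ ∷ s) (y′ ∷ t) (s⊆t ∘ suc))

  ⋂-sorted : ∀ {m} (t : Tuple (suc m)) → (∀ l → Linked _<_ (Vec.lookup t l)) → Linked _<_ (⋂ t)
  ⋂-sorted (x ∷ []) sorted = sorted zero
  ⋂-sorted (x ∷ y ∷ t) sorted = Linkedₚ.filter⁺ (λ v → v ∈ℕ? ⋂ (y ∷ t)) <-trans (sorted zero)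

  ⋂-∈ : ∀ {m} (t : Tuple m) {v} → v ∈ ⋂ t → ∀ l → v ∈ Vec.lookup t l
  ⋂-∈ (x ∷ []) v∈ zero = v∈
  ⋂-∈ (x ∷ y ∷ t) v∈ zero = proj₁ (∈-filter⁻ (λ v → v ∈ℕ? ⋂ (y ∷ t)) {xs = x} v∈)
  ⋂-∈ (x ∷ y ∷ t) v∈ (suc l) = ⋂-∈ (y ∷ t) (proj₂ (∈-filter⁻ (λ v → v ∈ℕ? ⋂ (y ∷ t)) {xs = x} v∈)) l

  ⋂-⊆ : ∀ {m} (t : Tuple (suc m)) → (∀ l → Linked _<_ (Vec.lookup t l)) → ∀ l → ⋂ t ⊆ Vec.lookup t l
  ⋂-⊆ t sorted l = sorted-⊆ (⋂-sorted t sorted) (sorted l) (λ v v∈ → ⋂-∈ t v∈ l)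

module HarmonicBetti where

  open import Function using (_∘_)
  open import Data.Nat as ℕ using (ℕ; zero; suc; _<_; _≤_)
  open import Data.Nat.Properties using (m≢1+n+m; ≮⇒≥; suc-injective)
  open import Data.Fin using (Fin)
  open import Data.Fin.Properties using (any?)
  open import Data.List using (List; []; allFin; map; length; lookup; filter)
  open import Data.Nat.ListAction using (sum)
  open import Data.List.Properties using (map-∘)
  open import Data.List.Membership.Propositional using (_∈_)
  open import Data.List.Membership.Propositional.Properties using (∈-filter⁺; ∈-filter⁻; ∈-map⁺; ∈-map⁻; ∈-lookup; ∈-allFin)
  open import Data.List.Relation.Unary.Unique.Propositional using (Unique)
  open import Data.List.Relation.Unary.AllPairs as AllPairs using (AllPairs)
  open import Data.List.Relation.Binary.Disjoint.Propositional using (Disjoint)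
  import Data.List.Relation.Unary.Unique.Propositional.Properties as Uniqueₚ
  import Data.Vec.Properties as Vecₚ
  open import Data.Rational using (ℚ; 0ℚ; _+_; _*_)
  open import Data.Rational.Properties using (*-zeroˡ; *-zeroʳ; *-assoc; *-comm; *-distribʳ-+; +-comm; +-identityˡ; +-identityʳ; _≟_)
  open import Data.Rational.Solver using (module +-*-Solver)
  open import Data.Product using (∃; _×_; _,_; proj₁; proj₂)
  open import Data.Empty using (⊥-elim)
  open import Relation.Binary.PropositionalEquality
  open import Relation.Nullary using (Dec; yes; no)
  open +-*-Solver using (solve; _:=_; _:*_)
  open import Defs
  open FiniteSum
  open LinearAlgebra
  open Lists
  open Tuples
  open TupleBoundary
  open FilteredComplex

  module _ {m : ℕ} where

    incidence : Tuple m → Tuple m → ℚ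
    incidence x y = dEntry y x

    open FilteredHarmonics incidence public

    level : List (Tuple m) → ℕ → List (Tuple m)
    level Λ j = filter (λ t → degree t ℕ.≟ j) Λ

    levelBelow : List (Tuple m) → ℕ → List (Tuple m)
    levelBelow Λ zero = []
    levelBelow Λ (suc j) = level Λ j

    degreeWindow : List (Tuple m) → ℕ → Window
    degreeWindow Λ k = window (levelBelow Λ k) (level Λ k) (level Λ (suc k))

    ∈-level⁻ : ∀ (Λ : List (Tuple m)) j {t} → t ∈ level Λ j → t ∈ Λ × degree t ≡ j
    ∈-level⁻ Λ j = ∈-filter⁻ (λ t → degree t ℕ.≟ j) {xs = Λ}

    ∈-level⁺ : ∀ (Λ : List (Tuple m)) j {t} → t ∈ Λ → degree t ≡ j → t ∈ level Λ j
    ∈-level⁺ Λ j = ∈-filter⁺ (λ t → degree t ℕ.≟ j)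

    level-unique : ∀ {Λ : List (Tuple m)} j → Unique Λ → Unique (level Λ j)
    level-unique j = Uniqueₚ.filter⁺ _

    AllNonempty : List (Tuple m) → Set
    AllNonempty Λ = ∀ t → t ∈ Λ → NonemptyEntries t

    D : Tuple m → Tuple m → ℚ
    D x y = dEntry x y + dEntry y x

    module Block (Λ : List (Tuple m)) (k : ℕ) where

      N = length Λ
      M = length (kIdx Λ k)

      kTuple : Fin M → Tuple m
      kTuple j = lookup Λ (lookup (kIdx Λ k) j)

      level≡map-kTuple : level Λ k ≡ map kTuple (allFin M)
      level≡map-kTuple = sym (begin
          map kTuple (allFin M)
        ≡⟨ map-∘ (allFin M) ⟩
          map (lookup Λ) (map (lookup (kIdx Λ k)) (allFin M))
        ≡⟨ cong (map (lookup Λ)) (map-lookup-allFin (kIdx Λ k)) ⟩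
          map (lookup Λ) (kIdx Λ k)
        ≡⟨ map-filter (λ t → degree t ℕ.≟ k) (lookup Λ) (allFin N) ⟩
          filter (λ t → degree t ℕ.≟ k) (map (lookup Λ) (allFin N))
        ≡⟨ cong (filter (λ t → degree t ℕ.≟ k)) (map-lookup-allFin Λ) ⟩
          level Λ k ∎)
        where open ≡-Reasoning

      ∑-level : ∀ F → ∑ (level Λ k) F ≡ ∑[ j < M ] F (kTuple j)
      ∑-level F = trans (cong (λ l → ∑ l F) level≡map-kTuple) (∑-map kTuple (allFin M) F)

      ∈-level⇒kTuple : ∀ {x} → x ∈ level Λ k → ∃ λ j → kTuple j ≡ x
      ∈-level⇒kTuple {x} x∈ with ∈-map⁻ kTuple (subst (x ∈_) level≡map-kTuple x∈)
      ... | j , _ , eq = j , sym eq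

      kTuple∈level : ∀ j → kTuple j ∈ level Λ k
      kTuple∈level j = subst (kTuple j ∈_) (sym level≡map-kTuple) (∈-map⁺ kTuple (∈-allFin j))

      kTuple-injective : Unique Λ → ∀ {i j} → kTuple i ≡ kTuple j → i ≡ j
      kTuple-injective unique eq = lookup-injective (Uniqueₚ.filter⁺ _ (Uniqueₚ.allFin⁺ N)) (lookup-injective unique eq)

      Dw : (Fin M → ℚ) → Fin N → ℚ
      Dw w c = ∑[ j < M ] (D (lookup Λ c) (kTuple j) * w j)

      LBlock≡D·Dw : ∀ w i → mulV (LBlock Λ k) w i ≡ ∑[ c < N ] (D (kTuple i) (lookup Λ c) * Dw w c)
      LBlock≡D·Dw w i = begin
          mulV (LBlock Λ k) w i
        ≡⟨ sumℚ-map _ (allFin M) ⟩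
          ∑[ j < M ] (LBlock Λ k i j * w j)
        ≡⟨ ∑-cong (allFin M) (λ j → trans (cong (_* w j) (sumℚ-map _ (allFin N)))
              (trans (sym (∑-*ʳ (allFin N) (w j) (λ c → D (kTuple i) (lookup Λ c) * D (lookup Λ c) (kTuple j))))
                     (∑-cong (allFin N) (λ c → *-assoc (D (kTuple i) (lookup Λ c)) (D (lookup Λ c) (kTuple j)) (w j))))) ⟩
          ∑[ j < M ] ∑[ c < N ] (D (kTuple i) (lookup Λ c) * (D (lookup Λ c) (kTuple j) * w j))
        ≡⟨ ∑-comm (allFin M) (allFin N) (λ j c → D (kTuple i) (lookup Λ c) * (D (lookup Λ c) (kTuple j) * w j)) ⟩
          ∑[ c < N ] ∑[ j < M ] (D (kTuple i) (lookup Λ c) * (D (lookup Λ c) (kTuple j) * w j))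
        ≡⟨ ∑-cong (allFin N) (λ c → ∑-*ˡ (allFin M) (D (kTuple i) (lookup Λ c)) (λ j → D (lookup Λ c) (kTuple j) * w j)) ⟩
          ∑[ c < N ] (D (kTuple i) (lookup Λ c) * Dw w c) ∎
        where open ≡-Reasoning

      -- D is symmetric, so wᵀ L w = ‖D w‖².
      quadratic-form : ∀ w → ∑[ i < M ] (w i * mulV (LBlock Λ k) w i) ≡ ∑[ c < N ] (Dw w c * Dw w c)
      quadratic-form w = begin
          ∑[ i < M ] (w i * mulV (LBlock Λ k) w i)
        ≡⟨ ∑-cong (allFin M) (λ i → trans (cong (w i *_) (LBlock≡D·Dw w i)) (sym (∑-*ˡ (allFin N) (w i) _))) ⟩
          ∑[ i < M ] ∑[ c < N ] (w i * (D (kTuple i) (lookup Λ c) * Dw w c))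
        ≡⟨ ∑-comm (allFin M) (allFin N) (λ i c → w i * (D (kTuple i) (lookup Λ c) * Dw w c)) ⟩
          ∑[ c < N ] ∑[ i < M ] (w i * (D (kTuple i) (lookup Λ c) * Dw w c))
        ≡⟨ ∑-cong (allFin N) (λ c → trans (∑-cong (allFin M) (λ i →
              trans (cong (λ z → w i * (z * Dw w c)) (+-comm (dEntry (kTuple i) (lookup Λ c)) (dEntry (lookup Λ c) (kTuple i))))
                    (solve 3 (λ a b g → a :* (b :* g) := (b :* a) :* g) refl (w i) (D (lookup Λ c) (kTuple i)) (Dw w c))))
              (∑-*ʳ (allFin M) (Dw w c) (λ i → D (lookup Λ c) (kTuple i) * w i))) ⟩
          ∑[ c < N ] (Dw w c * Dw w c) ∎
        where open ≡-Reasoning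

      kernel⇒Dw≡0 : ∀ w → (∀ i → mulV (LBlock Λ k) w i ≡ 0ℚ) → ∀ c → Dw w c ≡ 0ℚ
      kernel⇒Dw≡0 w Lw≡0 c = ∑-squares≡0⇒≡0 (allFin N) (Dw w)
        (trans (sym (quadratic-form w)) (∑-zero (allFin M) (λ i → trans (cong (w i *_) (Lw≡0 i)) (*-zeroʳ (w i))))) c (∈-allFin c)

      Dw≡0⇒kernel : ∀ w → (∀ c → Dw w c ≡ 0ℚ) → ∀ i → mulV (LBlock Λ k) w i ≡ 0ℚ
      Dw≡0⇒kernel w Dw≡0 i = trans (LBlock≡D·Dw w i)
        (∑-zero (allFin N) (λ c → trans (cong (D (kTuple i) (lookup Λ c) *_) (Dw≡0 c)) (*-zeroʳ (D (kTuple i) (lookup Λ c)))))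

    module _ (Λ : List (Tuple m)) (nonempty : AllNonempty Λ) (k : ℕ) where

      Df : (Tuple m → ℚ) → Tuple m → ℚ
      Df f x = ∑[ s ∈ level Λ k ] (D x s * f s)

      private
        Df-split : ∀ (f : Tuple m → ℚ) x → Df f x ≡ ∑[ s ∈ level Λ k ] (dEntry x s * f s) + ∑[ s ∈ level Λ k ] (dEntry s x * f s)
        Df-split f x = trans (∑-cong (level Λ k) (λ s → *-distribʳ-+ (f s) (dEntry x s) (dEntry s x)))
                             (∑-+ (level Λ k) (λ s → dEntry x s * f s) (λ s → dEntry s x * f s))

        boundary-off-degree : ∀ (f : Tuple m → ℚ) x → degree x ≢ suc k → ∑[ s ∈ level Λ k ] (dEntry x s * f s) ≡ 0ℚ
        boundary-off-degree f x degree≢ = ∑-zero-on (level Λ k) term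
          where
          term : ∀ s → s ∈ level Λ k → dEntry x s * f s ≡ 0ℚ
          term s s∈ with dEntry x s ≟ 0ℚ
          ... | yes dEntry≡0 = trans (cong (_* f s) dEntry≡0) (*-zeroˡ (f s))
          ... | no dEntry≢0 = ⊥-elim (degree≢ (trans (dEntry≢0⇒degree x s (nonempty s (proj₁ (∈-level⁻ Λ k s∈))) dEntry≢0)
                                                     (cong suc (proj₂ (∈-level⁻ Λ k s∈)))))

        coboundary-off-degree : ∀ (f : Tuple m → ℚ) x → x ∈ Λ → k ≢ suc (degree x) → ∑[ s ∈ level Λ k ] (dEntry s x * f s) ≡ 0ℚ
        coboundary-off-degree f x x∈Λ degree≢ = ∑-zero-on (level Λ k) term
          where
          term : ∀ s → s ∈ level Λ k → dEntry s x * f s ≡ 0ℚ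
          term s s∈ with dEntry s x ≟ 0ℚ
          ... | yes dEntry≡0 = trans (cong (_* f s) dEntry≡0) (*-zeroˡ (f s))
          ... | no dEntry≢0 = ⊥-elim (degree≢ (trans (sym (proj₂ (∈-level⁻ Λ k s∈))) (dEntry≢0⇒degree s x (nonempty x x∈Λ) dEntry≢0)))

      harmonic⇒Df≡0 : ∀ (f : Tuple m → ℚ) → Harmonic (degreeWindow Λ k) f → ∀ x → x ∈ Λ → Df f x ≡ 0ℚ
      harmonic⇒Df≡0 f (coclosed , closed) x x∈Λ = trans (Df-split f x) (cases (degree x ℕ.≟ suc k) (k ℕ.≟ suc (degree x)))
        where
        cases : Dec (degree x ≡ suc k) → Dec (k ≡ suc (degree x)) →
          ∑[ s ∈ level Λ k ] (dEntry x s * f s) + ∑[ s ∈ level Λ k ] (dEntry s x * f s) ≡ 0ℚ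
        cases (yes x∈upper) _ = cong₂ _+_ (closed x (∈-level⁺ Λ (suc k) x∈Λ x∈upper))
          (coboundary-off-degree f x x∈Λ (λ k≡ → m≢1+n+m k {1} (trans k≡ (cong suc x∈upper))))
        cases (no x∉upper) (yes refl) = trans (cong₂ _+_ (boundary-off-degree f x x∉upper) (coclosed x (∈-level⁺ Λ (degree x) x∈Λ refl)))
                                              (+-identityˡ 0ℚ)
        cases (no x∉upper) (no x∉lower) = cong₂ _+_ (boundary-off-degree f x x∉upper) (coboundary-off-degree f x x∈Λ x∉lower)

      Df≡0⇒harmonic : ∀ (f : Tuple m → ℚ) → (∀ x → x ∈ Λ → Df f x ≡ 0ℚ) → Harmonic (degreeWindow Λ k) f
      Df≡0⇒harmonic f Df≡0 = coclosed k refl , closed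
        where
        closed : Closed (degreeWindow Λ k) f
        closed u u∈ = trans (sym (+-identityʳ _))
          (trans (cong (∑[ s ∈ level Λ k ] (dEntry u s * f s) +_) (sym (coboundary-off-degree f u u∈Λ (λ k≡ → m≢1+n+m k {1} (trans k≡ (cong suc degree-u))))))
                 (trans (sym (Df-split f u)) (Df≡0 u u∈Λ)))
          where
          u∈Λ = proj₁ (∈-level⁻ Λ (suc k) u∈)
          degree-u = proj₂ (∈-level⁻ Λ (suc k) u∈)
        coclosed : ∀ k′ → k′ ≡ k → ∀ t → t ∈ levelBelow Λ k′ → ∑[ s ∈ level Λ k ] (dEntry s t * f s) ≡ 0ℚ
        coclosed (suc j) refl t t∈ = trans (sym (+-identityˡ _))
          (trans (cong (_+ ∑[ s ∈ level Λ k ] (dEntry s t * f s)) (sym (boundary-off-degree f t (λ degree≡ → m≢1+n+m j {1} (trans (sym degree-t) degree≡)))))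
                 (trans (sym (Df-split f t)) (Df≡0 t t∈Λ)))
          where
          t∈Λ = proj₁ (∈-level⁻ Λ j t∈)
          degree-t = proj₂ (∈-level⁻ Λ j t∈)

    module HarmonicBasis (Λ : List (Tuple m)) (nonempty : AllNonempty Λ) (k : ℕ) {r} (betti : IsBetti Λ k r) where

      open Block Λ k

      private
        v : Fin r → Fin M → ℚ
        v = proj₁ betti

        v-kernel : ∀ a i → mulV (LBlock Λ k) (v a) i ≡ 0ℚ
        v-kernel = proj₁ (proj₂ betti)

        v-independent : ∀ c → (∀ i → lincomb c v i ≡ 0ℚ) → ∀ a → c a ≡ 0ℚ
        v-independent = proj₁ (proj₂ (proj₂ betti))

        v-spans : ∀ w → (∀ i → mulV (LBlock Λ k) w i ≡ 0ℚ) → ∃ λ c → ∀ i → w i ≡ lincomb c v i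
        v-spans = proj₂ (proj₂ (proj₂ betti))

        lincomb≡linComb : ∀ c i → lincomb c v i ≡ linComb c v i
        lincomb≡linComb c i = sumℚ-map _ (allFin r)

        Df≡Dw : ∀ f c → Df Λ nonempty k f (lookup Λ c) ≡ Dw (f ∘ kTuple) c
        Df≡Dw f c = ∑-level (λ s → D (lookup Λ c) s * f s)

      harmonicBasis : Fin r → Tuple m → ℚ
      harmonicBasis a x with any? (λ j → Vecₚ.≡-dec _≟S_ (kTuple j) x)
      ... | yes (j , _) = v a j
      ... | no _ = 0ℚ

      harmonicBasis-level : ∀ x → x ∈ level Λ k → ∃ λ j → kTuple j ≡ x × (∀ a → harmonicBasis a x ≡ v a j)
      harmonicBasis-level x x∈ with any? (λ j → Vecₚ.≡-dec _≟S_ (kTuple j) x)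
      ... | yes (j , kTupleⱼ≡x) = j , kTupleⱼ≡x , (λ a → refl)
      ... | no ∄j = ⊥-elim (∄j (∈-level⇒kTuple x∈))

      harmonicBasis-spans : Spans (degreeWindow Λ k) harmonicBasis
      harmonicBasis-spans f f-harmonic = c , λ x x∈ →
        let (j , kTupleⱼ≡x , basis≡) = harmonicBasis-level x x∈
        in trans (cong f (sym kTupleⱼ≡x)) (trans (c-spans j) (trans (lincomb≡linComb c j)
             (∑-cong (allFin r) (λ a → cong (c a *_) (sym (basis≡ a))))))
        where
        f-kernel : ∀ i → mulV (LBlock Λ k) (f ∘ kTuple) i ≡ 0ℚ
        f-kernel = Dw≡0⇒kernel (f ∘ kTuple)
          (λ c → trans (sym (Df≡Dw f c)) (harmonic⇒Df≡0 Λ nonempty k f f-harmonic (lookup Λ c) (∈-lookup c)))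
        c = proj₁ (v-spans (f ∘ kTuple) f-kernel)
        c-spans = proj₂ (v-spans (f ∘ kTuple) f-kernel)

      module _ (unique : Unique Λ) where

        harmonicBasis-kTuple : ∀ a j → harmonicBasis a (kTuple j) ≡ v a j
        harmonicBasis-kTuple a j with harmonicBasis-level (kTuple j) (kTuple∈level j)
        ... | j′ , kTupleⱼ′≡kTupleⱼ , basis≡ = trans (basis≡ a) (cong (v a) (kTuple-injective unique kTupleⱼ′≡kTupleⱼ))

        harmonicBasis-harmonic : ∀ c → Harmonic (degreeWindow Λ k) (linComb c harmonicBasis)
        harmonicBasis-harmonic c = Df≡0⇒harmonic Λ nonempty k (linComb c harmonicBasis) Df≡0
          where
          Df≡0 : ∀ x → x ∈ Λ → Df Λ nonempty k (linComb c harmonicBasis) x ≡ 0ℚ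
          Df≡0 x x∈Λ with ∈⇒lookup x∈Λ
          ... | i , refl = begin
              Df Λ nonempty k (linComb c harmonicBasis) (lookup Λ i)
            ≡⟨ Df≡Dw (linComb c harmonicBasis) i ⟩
              ∑[ j < M ] (D (lookup Λ i) (kTuple j) * linComb c harmonicBasis (kTuple j))
            ≡⟨ ∑-cong (allFin M) (λ j → cong (D (lookup Λ i) (kTuple j) *_) (∑-cong (allFin r) (λ a → cong (c a *_) (harmonicBasis-kTuple a j)))) ⟩
              ∑[ j < M ] (D (lookup Λ i) (kTuple j) * linComb c v j)
            ≡⟨ ∑-*-linComb (allFin M) (λ j → D (lookup Λ i) (kTuple j)) c v ⟩
              ∑[ a < r ] (c a * Dw (v a) i)
            ≡⟨ ∑-zero (allFin r) (λ a → trans (cong (c a *_) (kernel⇒Dw≡0 (v a) (v-kernel a) i)) (*-zeroʳ (c a))) ⟩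
              0ℚ ∎
            where open ≡-Reasoning

        harmonicBasis-independent : ∀ c → VanishesOn (level Λ k) (linComb c harmonicBasis) → ∀ a → c a ≡ 0ℚ
        harmonicBasis-independent c vanishes = v-independent c (λ j → trans (lincomb≡linComb c j)
          (trans (∑-cong (allFin r) (λ a → cong (c a *_) (sym (harmonicBasis-kTuple a j)))) (vanishes (kTuple j) (kTuple∈level j))))

    betti≤ : ∀ (Λ : List (Tuple m)) → Unique Λ → AllNonempty Λ → ∀ k {r t} → IsBetti Λ k r →
      Dim≤ (Harmonic (degreeWindow Λ k)) (level Λ k) t → r ≤ t
    betti≤ Λ unique nonempty k {r} {t} betti dim with t ℕ.<? r
    ... | no t≮r = ≮⇒≥ t≮r
    ... | yes t<r =
      let (c , (a , cₐ≢0) , vanishes) = dim r t<r harmonicBasis (harmonicBasis-harmonic unique)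
      in ⊥-elim (cₐ≢0 (harmonicBasis-independent unique c vanishes a))
      where open HarmonicBasis Λ nonempty k betti

    levelBelow⊆ : ∀ (Λ : List (Tuple m)) k {t} → t ∈ levelBelow Λ k → t ∈ Λ
    levelBelow⊆ Λ (suc j) t∈ = proj₁ (∈-level⁻ Λ j t∈)

    level-mono : ∀ {Λ Λ′ : List (Tuple m)} j → (∀ {x} → x ∈ Λ′ → x ∈ Λ) → ∀ {x} → x ∈ level Λ′ j → x ∈ level Λ j
    level-mono {Λ} {Λ′} j Λ′⊆Λ x∈ = ∈-level⁺ Λ j (Λ′⊆Λ (proj₁ (∈-level⁻ Λ′ j x∈))) (proj₂ (∈-level⁻ Λ′ j x∈))

    levelBelow-mono : ∀ {Λ Λ′ : List (Tuple m)} k → (∀ {x} → x ∈ Λ′ → x ∈ Λ) → ∀ {x} → x ∈ levelBelow Λ′ k → x ∈ levelBelow Λ k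
    levelBelow-mono (suc j) = level-mono j

    FaceClosed : List (Tuple m) → Set
    FaceClosed Λ = ∀ u t → u ∈ Λ → t ∈ Λ → ∀ l i → dEntry (face u l i) t ≢ 0ℚ → face u l i ∈ Λ

    degreeWindow-∂²≡0 : ∀ (Λ : List (Tuple m)) → Unique Λ → AllNonempty Λ → FaceClosed Λ → ∀ k → ∂²≡0 (degreeWindow Λ k)
    degreeWindow-∂²≡0 Λ unique nonempty faceClosed k t u t∈ u∈ = begin
        ∑[ s ∈ level Λ k ] (dEntry s t * dEntry u s)
      ≡⟨ ∑-cong (level Λ k) (λ s → *-comm (dEntry s t) (dEntry u s)) ⟩
        ∑[ s ∈ level Λ k ] (dEntry u s * dEntry s t)
      ≡⟨ ∑-dEntry (level Λ k) u (λ s → dEntry s t) (level-unique k unique) faces∈level ⟩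
        ∂ᵗ (λ s → dEntry s t) u
      ≡⟨ ∂ᵗ-cong (λ s → dEntry≡∂ᵗδ s t) u ⟩
        ∂ᵗ (∂ᵗ (λ r → δ r t)) u
      ≡⟨ ∂ᵗ∘∂ᵗ≡0 (λ r → δ r t) (δ-vanishesOnEmptyEntries (nonempty t t∈Λ)) u ⟩
        0ℚ ∎
      where
      open ≡-Reasoning
      t∈Λ = levelBelow⊆ Λ k t∈
      u∈Λ = proj₁ (∈-level⁻ Λ (suc k) u∈)
      faces∈level : ∀ l i → dEntry (face u l i) t ≢ 0ℚ → face u l i ∈ level Λ k
      faces∈level l i dEntry≢0 = ∈-level⁺ Λ k (faceClosed u t u∈Λ t∈Λ l i dEntry≢0)
        (suc-injective (trans (sym (degree-face u l i face-nonempty)) (proj₂ (∈-level⁻ Λ (suc k) u∈))))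
        where
        face-nonempty : NonemptyEntries (face u l i)
        face-nonempty l′ = ⊆-nonempty (dEntry≢0⇒⊆ (face u l i) t dEntry≢0 l′) (nonempty t t∈Λ l′)

    NoFaceAmong : List (Tuple m) → List (Tuple m) → Set
    NoFaceAmong Λ Λ′ = ∀ x y → x ∈ Λ′ → y ∈ Λ → dEntry x y ≡ 0ℚ

    NoFaceIn-degreeWindow : ∀ {Λ Λ′ : List (Tuple m)} → NoFaceAmong Λ Λ′ → ∀ k → NoFaceIn (degreeWindow Λ k) (degreeWindow Λ′ k)
    NoFaceIn-degreeWindow {Λ} {Λ′} noFace k =
      (λ t s t∈ s∈ → noFace s t (proj₁ (∈-level⁻ Λ′ k s∈)) (levelBelow⊆ Λ k t∈)) ,
      (λ s u s∈ u∈ → noFace u s (proj₁ (∈-level⁻ Λ′ (suc k) u∈)) (proj₁ (∈-level⁻ Λ k s∈)))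

    record IsPartition {I : Set} (Λ : List (Tuple m)) (piece : I → List (Tuple m)) (is : List I) : Set where
      field
        unique : ∀ i → Unique (piece i)
        disjoint : AllPairs (λ i j → Disjoint (piece i) (piece j)) is
        covers : ∀ {x} → x ∈ Λ → ∃ λ i → i ∈ is × x ∈ piece i
        ⊆whole : ∀ i {x} → x ∈ piece i → x ∈ Λ

    module _ {I : Set} {Λ : List (Tuple m)} {piece : I → List (Tuple m)} {is : List I}
             (Λ-unique : Unique Λ) (partition : IsPartition Λ piece is) (k : ℕ) where

      open IsPartition partition

      private
        W : I → Window
        W i = degreeWindow (piece i) k

      ⨁-pieces⊑ : ⨁ (map W is) ⊑ degreeWindow Λ k
      ⨁-pieces⊑ = record
        { lower⊆ = λ x∈ → let (i , _ , x∈Wᵢ) = ∈-⨁⁻ W lower (λ _ _ → refl) refl is x∈ in levelBelow-mono k (⊆whole i) x∈Wᵢ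
        ; upper⊆ = λ x∈ → let (i , _ , x∈Wᵢ) = ∈-⨁⁻ W upper (λ _ _ → refl) refl is x∈ in level-mono (suc k) (⊆whole i) x∈Wᵢ
        ; middle⊇ = λ x∈ → let (x∈Λ , degree≡k) = ∈-level⁻ Λ k x∈ ; (i , i∈ , x∈piece) = covers x∈Λ
                           in ∈-middle-⨁⁺ W is i∈ (∈-level⁺ (piece i) k x∈piece degree≡k)
        ; ∑-middle = λ g → ∑-same-elements (Vecₚ.≡-dec _≟S_) _ _ g
            (middle-⨁-unique W (λ i → level-unique k (unique i)) is (AllPairs.map disjoint-level disjoint))
            (level-unique k Λ-unique)
            (λ x x∈ → let (i , _ , x∈Wᵢ) = ∈-⨁⁻ W middle (λ _ _ → refl) refl is x∈ in level-mono k (⊆whole i) x∈Wᵢ)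
            (λ x x∈ → let (x∈Λ , degree≡k) = ∈-level⁻ Λ k x∈ ; (i , i∈ , x∈piece) = covers x∈Λ
                      in ∈-middle-⨁⁺ W is i∈ (∈-level⁺ (piece i) k x∈piece degree≡k))
        }
        where
        disjoint-level : ∀ {i j} → Disjoint (piece i) (piece j) → Disjoint (level (piece i) k) (level (piece j) k)
        disjoint-level {i} {j} disjointᵢⱼ (x∈i , x∈j) = disjointᵢⱼ (proj₁ (∈-level⁻ (piece i) k x∈i) , proj₁ (∈-level⁻ (piece j) k x∈j))

    -- Pieces listed so that no tuple has a face in an earlier piece form a filtration.
    betti-subadditive : ∀ {I : Set} {Λ : List (Tuple m)} {piece : I → List (Tuple m)} {is : List I} →
      Unique Λ → AllNonempty Λ → FaceClosed Λ → IsPartition Λ piece is →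
      AllPairs (λ i j → NoFaceAmong (piece i) (piece j)) is →
      ∀ k {b} (bᵢ : I → ℕ) → IsBetti Λ k b → (∀ i → IsBetti (piece i) k (bᵢ i)) → b ≤ sum (map bᵢ is)
    betti-subadditive {Λ = Λ} {piece} {is} unique nonempty faceClosed partition noFaces k bᵢ betti bettiᵢ =
      betti≤ Λ unique nonempty k betti
        (Dim≤-⊑ (⨁-pieces⊑ unique partition k)
          (Dim≤-harmonic-⨁ W bᵢ generators spans is (AllPairs.map (λ noFace → NoFaceIn-degreeWindow noFace k) noFaces)
            (∂²≡0-⊑ (⨁-pieces⊑ unique partition k) (degreeWindow-∂²≡0 Λ unique nonempty faceClosed k))))
      where
      W : _ → Window
      W i = degreeWindow (piece i) k
      piece-nonempty : ∀ i → AllNonempty (piece i)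
      piece-nonempty i t t∈ = nonempty t (IsPartition.⊆whole partition i t∈)
      generators : ∀ i → Fin (bᵢ i) → Tuple m → ℚ
      generators i = HarmonicBasis.harmonicBasis (piece i) (piece-nonempty i) k (bettiᵢ i)
      spans : ∀ i → Spans (W i) (generators i)
      spans i = HarmonicBasis.harmonicBasis-spans (piece i) (piece-nonempty i) k (bettiᵢ i)

module Decomposition where

  open import Data.Nat as ℕ using (ℕ; zero; suc)
  open import Data.Bool using (Bool; true; false; if_then_else_; not)
  open import Data.Fin using (zero; suc)
  open import Data.List using (List; []; _∷_; _++_; map)
  open import Data.List.Membership.Propositional using (_∈_; _∉_)
  open import Data.List.Membership.Propositional.Properties using (∈-filter⁺; ∈-filter⁻; ∈-map⁺; ∈-map⁻; ∈-++⁻)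
  import Data.List.Membership.DecPropositional as DecMembership
  open import Data.List.Relation.Unary.Any using (here; there)
  open import Data.List.Relation.Unary.All as All using (All; []; _∷_)
  import Data.List.Relation.Unary.All.Properties as Allₚ
  open import Data.List.Relation.Unary.AllPairs as AllPairs using (AllPairs; []; _∷_)
  import Data.List.Relation.Unary.AllPairs.Properties as AllPairsₚ
  open import Data.List.Relation.Unary.Unique.Propositional using (Unique)
  import Data.List.Relation.Unary.Unique.Propositional.Properties as Uniqueₚ
  open import Data.List.Relation.Unary.Linked using (Linked)
  open import Data.List.Relation.Binary.Sublist.Propositional using (_⊆_)
  open import Data.List.Relation.Binary.Disjoint.Propositional using (Disjoint)
  open import Data.Vec as Vec using (Vec; []; _∷_)
  import Data.Vec.Properties as Vecₚ
  open import Data.Vec.Relation.Binary.Pointwise.Extensional using (ext; Pointwise-≡⇒≡)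
  open import Data.Maybe using (Maybe; just; nothing)
  open import Data.Rational using (0ℚ)
  import Data.Rational.Properties as ℚ
  open import Data.Product using (∃; _×_; _,_; proj₁; proj₂)
  open import Data.Sum using (inj₁; inj₂)
  open import Data.Empty using (⊥-elim)
  open import Relation.Binary.PropositionalEquality
  open import Relation.Nullary using (¬_; Dec; yes; no; ¬?)
  open import Relation.Nullary.Decidable using (⌊_⌋; decidable-stable)
  open import Defs
  open Lists
  open Tuples
  open HarmonicBetti

  open DecMembership _≟S_ using () renaming (_∈?_ to _∈S?_)

  _≼_ : ∀ {n} → Vec Bool n → Vec Bool n → Set
  X ≼ X′ = ∀ l → Vec.lookup X l ≡ true → Vec.lookup X′ l ≡ true

  -- power lists the patterns in decreasing lexicographic order (true first).
  power-antitone : ∀ n → AllPairs (λ X X′ → ¬ X ≼ X′) (power (true ∷ false ∷ []) n)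
  power-antitone zero = [] ∷ []
  power-antitone (suc n) =
    AllPairsₚ.++⁺ (AllPairsₚ.map⁺ (AllPairs.map ∷-antitone (power-antitone n)))
                 (AllPairsₚ.++⁺ (AllPairsₚ.map⁺ (AllPairs.map ∷-antitone (power-antitone n))) [] (All.tabulate (λ _ → [])))
                 (All.tabulate true-first)
    where
    ∷-antitone : ∀ {b} {X X′ : Vec Bool n} → ¬ X ≼ X′ → ¬ (b ∷ X) ≼ (b ∷ X′)
    ∷-antitone X⋠X′ X≼X′ = X⋠X′ (λ l → X≼X′ (suc l))
    true-first : ∀ {X} → X ∈ map (true ∷_) (power (true ∷ false ∷ []) n) →
      All (λ X′ → ¬ X ≼ X′) (map (false ∷_) (power (true ∷ false ∷ []) n) ++ [])
    true-first X∈ with ∈-map⁻ (true ∷_) X∈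
    ... | _ , _ , refl = All.tabulate λ {X′} X′∈ X≼X′ → lemma X′ X′∈ (X≼X′ zero refl)
      where
      lemma : ∀ X′ → X′ ∈ map (false ∷_) (power (true ∷ false ∷ []) n) ++ [] → Vec.lookup X′ zero ≢ true
      lemma X′ X′∈ with ∈-++⁻ (map (false ∷_) (power (true ∷ false ∷ []) n)) X′∈
      ... | inj₂ ()
      ... | inj₁ X′∈′ with ∈-map⁻ (false ∷_) X′∈′
      ... | _ , _ , refl = λ ()

  module Pieces (G K : List Simplex) (G-complex : IsComplex G) (K-subcomplex : IsSubcomplex K G) (m : ℕ) where

    U : List Simplex
    U = diff G K

    private
      G-unique : Unique G
      G-unique = proj₁ G-complex

      G-closed : ∀ {x y} → x ∈ G → y ⊆ x → y ≢ [] → y ∈ G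
      G-closed = proj₂ (proj₂ G-complex)

      K-closed : ∀ {x y} → x ∈ K → y ⊆ x → y ≢ [] → y ∈ K
      K-closed = proj₂ (proj₂ (proj₁ K-subcomplex))

      K⊆G : ∀ {x} → x ∈ K → x ∈ G
      K⊆G = proj₂ K-subcomplex

      G-nonempty : ∀ {x} → x ∈ G → x ≢ []
      G-nonempty x∈ = proj₁ (All.lookup (proj₁ (proj₂ G-complex)) x∈)

      G-sorted : ∀ {x} → x ∈ G → Linked ℕ._<_ x
      G-sorted x∈ = proj₂ (All.lookup (proj₁ (proj₂ G-complex)) x∈)

      ∈U⁻ : ∀ {x} → x ∈ U → x ∈ G × x ∉ K
      ∈U⁻ = ∈-filter⁻ (λ x → ¬? (x ∈S? K)) {xs = G}

      ∈U⁺ : ∀ {x} → x ∈ G → x ∉ K → x ∈ U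
      ∈U⁺ = ∈-filter⁺ (λ x → ¬? (x ∈S? K))

    part : Bool → List Simplex
    part b = if b then U else K

    private
      part⊆G : ∀ b {x} → x ∈ part b → x ∈ G
      part⊆G true x∈ = proj₁ (∈U⁻ x∈)
      part⊆G false x∈ = K⊆G x∈

      part-unique : ∀ b → Unique (part b)
      part-unique true = Uniqueₚ.filter⁺ _ G-unique
      part-unique false = proj₁ (proj₁ K-subcomplex)

      part-injective : ∀ b b′ {y} → y ∈ part b → y ∈ part b′ → b ≡ b′
      part-injective true true _ _ = refl
      part-injective false false _ _ = refl
      part-injective true false y∈U y∈K = ⊥-elim (proj₂ (∈U⁻ y∈U) y∈K)
      part-injective false true y∈K y∈U = ⊥-elim (proj₂ (∈U⁻ y∈U) y∈K)

      lookup-parts : ∀ (X : Vec Bool m) l → Vec.lookup (Vec.map part X) l ≡ part (Vec.lookup X l)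
      lookup-parts X l = Vecₚ.lookup-map l part X

      ⋂⊆ : ∀ {n} (t : Vec Simplex n) → (∀ l → Vec.lookup t l ∈ G) → ∀ l → ⋂ t ⊆ Vec.lookup t l
      ⋂⊆ (x ∷ t) t∈G = ⋂-⊆ (x ∷ t) (λ l → G-sorted (t∈G l))

      ⋂∈G : ∀ {n} (t : Vec Simplex n) → (∀ l → Vec.lookup t l ∈ G) → ⋂ t ≢ [] → ⋂ t ∈ G
      ⋂∈G [] _ ⋂≢[] = ⊥-elim (⋂≢[] refl)
      ⋂∈G (x ∷ t) t∈G ⋂≢[] = G-closed (t∈G zero) (⋂⊆ (x ∷ t) t∈G zero) ⋂≢[]

    ∈ΛG⁻ : ∀ {t} → t ∈ ΛG G m → (∀ l → Vec.lookup t l ∈ G) × ⋂ t ≢ []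
    ∈ΛG⁻ {t} t∈ = let (t∈Gᵐ , ⋂≢[]) = ∈-filter⁻ (λ t → ¬? (⋂ t ≟S [])) {xs = power G m} t∈ in ∈-power⁻ G m t t∈Gᵐ , ⋂≢[]

    ∈ΛG⁺ : ∀ {t} → (∀ l → Vec.lookup t l ∈ G) → ⋂ t ≢ [] → t ∈ ΛG G m
    ∈ΛG⁺ {t} t∈G ⋂≢[] = ∈-filter⁺ (λ t → ¬? (⋂ t ≟S [])) (∈-power⁺ G m t t∈G) ⋂≢[]

    ∈ΛU⁻ : ∀ {t} → t ∈ ΛU G K m → (∀ l → Vec.lookup t l ∈ U) × ⋂ t ∈ U
    ∈ΛU⁻ {t} t∈ = let (t∈Uᵐ , ⋂∈U) = ∈-filter⁻ (λ t → ⋂ t ∈S? U) {xs = power U m} t∈ in ∈-power⁻ U m t t∈Uᵐ , ⋂∈U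

    ∈ΛU⁺ : ∀ {t} → (∀ l → Vec.lookup t l ∈ U) → ⋂ t ∈ U → t ∈ ΛU G K m
    ∈ΛU⁺ {t} t∈U ⋂∈U = ∈-filter⁺ (λ t → ⋂ t ∈S? U) (∈-power⁺ U m t t∈U) ⋂∈U

    ∈ΛX⁻ : ∀ X {t} → t ∈ ΛX G K m X → (∀ l → Vec.lookup t l ∈ part (Vec.lookup X l)) × ⋂ t ∈ K
    ∈ΛX⁻ X {t} t∈ =
      let (t∈∏ , ⋂∈K) = ∈-filter⁻ (λ t → ⋂ t ∈S? K) {xs = prodL (Vec.map part X)} t∈
      in (λ l → subst (Vec.lookup t l ∈_) (lookup-parts X l) (∈-prodL⁻ (Vec.map part X) t t∈∏ l)) , ⋂∈K

    ∈ΛX⁺ : ∀ X {t} → (∀ l → Vec.lookup t l ∈ part (Vec.lookup X l)) → ⋂ t ∈ K → t ∈ ΛX G K m X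
    ∈ΛX⁺ X {t} t∈parts ⋂∈K = ∈-filter⁺ (λ t → ⋂ t ∈S? K)
      (∈-prodL⁺ (Vec.map part X) t (λ l → subst (Vec.lookup t l ∈_) (sym (lookup-parts X l)) (t∈parts l))) ⋂∈K

    ΛG-unique : Unique (ΛG G m)
    ΛG-unique = Uniqueₚ.filter⁺ _ (power-unique G m G-unique)

    ΛG-nonempty : AllNonempty (ΛG G m)
    ΛG-nonempty t t∈ l = G-nonempty (proj₁ (∈ΛG⁻ t∈) l)

    ΛG-faceClosed : FaceClosed (ΛG G m)
    ΛG-faceClosed u t u∈ t∈ l i dEntry≢0 = ∈ΛG⁺ face∈G (⊆-nonempty (⋂-mono t f t⊆f) (proj₂ (∈ΛG⁻ t∈)))
      where
      f = face u l i
      t⊆f : ∀ l′ → Vec.lookup t l′ ⊆ Vec.lookup f l′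
      t⊆f = dEntry≢0⇒⊆ f t dEntry≢0
      face∈G : ∀ l′ → Vec.lookup f l′ ∈ G
      face∈G l′ = G-closed (proj₁ (∈ΛG⁻ u∈) l′) (face-⊆ u l i l′) (⊆-nonempty (t⊆f l′) (ΛG-nonempty t t∈ l′))

    Piece : Set
    Piece = Maybe (Vec Bool m)

    patterns : List (Vec Bool m)
    patterns = power (true ∷ false ∷ []) m

    pieces : List Piece
    pieces = nothing ∷ map just patterns

    piece : Piece → List (Tuple m)
    piece nothing = ΛU G K m
    piece (just X) = ΛX G K m X

    private
      patternOf : Tuple m → Vec Bool m
      patternOf t = Vec.map (λ y → not ⌊ y ∈S? K ⌋) t

      ∈-part-pattern : ∀ y → y ∈ G → (y∈K? : Dec (y ∈ K)) → y ∈ part (not ⌊ y∈K? ⌋)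
      ∈-part-pattern y y∈G (yes y∈K) = y∈K
      ∈-part-pattern y y∈G (no y∉K) = ∈U⁺ y∈G y∉K

      classify : ∀ {t} → t ∈ ΛG G m → ∃ λ i → i ∈ pieces × t ∈ piece i
      classify {t} t∈ with ⋂ t ∈S? K
      ... | yes ⋂∈K = just (patternOf t) ,
            there (∈-map⁺ just (∈-power⁺ (true ∷ false ∷ []) m (patternOf t) (λ l → any-bool (Vec.lookup (patternOf t) l)))) ,
            ∈ΛX⁺ (patternOf t) (λ l → subst (λ b → Vec.lookup t l ∈ part b) (sym (Vecₚ.lookup-map l _ t))
                                          (∈-part-pattern (Vec.lookup t l) (proj₁ (∈ΛG⁻ t∈) l) (Vec.lookup t l ∈S? K))) ⋂∈K
        where
        any-bool : ∀ b → b ∈ true ∷ false ∷ []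
        any-bool true = here refl
        any-bool false = there (here refl)
      ... | no ⋂∉K = nothing , here refl ,
            ∈ΛU⁺ (λ l → ∈U⁺ (t∈G l) (λ tₗ∈K → ⋂∉K (K-closed tₗ∈K (⋂⊆ t t∈G l) ⋂≢[])))
                 (∈U⁺ (⋂∈G t t∈G ⋂≢[]) ⋂∉K)
        where
        t∈G = proj₁ (∈ΛG⁻ t∈)
        ⋂≢[] = proj₂ (∈ΛG⁻ t∈)

      piece⊆ΛG : ∀ i {t} → t ∈ piece i → t ∈ ΛG G m
      piece⊆ΛG nothing t∈ = ∈ΛG⁺ (λ l → proj₁ (∈U⁻ (proj₁ (∈ΛU⁻ t∈) l))) (G-nonempty (proj₁ (∈U⁻ (proj₂ (∈ΛU⁻ t∈)))))
      piece⊆ΛG (just X) t∈ = ∈ΛG⁺ (λ l → part⊆G (Vec.lookup X l) (proj₁ (∈ΛX⁻ X t∈) l)) (G-nonempty (K⊆G (proj₂ (∈ΛX⁻ X t∈))))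

      piece-unique : ∀ i → Unique (piece i)
      piece-unique nothing = Uniqueₚ.filter⁺ _ (power-unique U m (part-unique true))
      piece-unique (just X) = Uniqueₚ.filter⁺ _
        (prodL-unique (Vec.map part X) (λ l → subst Unique (sym (lookup-parts X l)) (part-unique (Vec.lookup X l))))

      pattern-determined : ∀ X X′ {t} → t ∈ ΛX G K m X → t ∈ ΛX G K m X′ → X ≡ X′
      pattern-determined X X′ t∈X t∈X′ = Pointwise-≡⇒≡ (ext (λ l → part-injective _ _ (proj₁ (∈ΛX⁻ X t∈X) l) (proj₁ (∈ΛX⁻ X′ t∈X′) l)))

      pieces-disjoint : AllPairs (λ i j → Disjoint (piece i) (piece j)) pieces
      pieces-disjoint =
        Allₚ.map⁺ (All.tabulate (λ {X} _ {_} (t∈U , t∈X) → proj₂ (∈U⁻ (proj₂ (∈ΛU⁻ t∈U))) (proj₂ (∈ΛX⁻ X t∈X)))) ∷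
        AllPairsₚ.map⁺ (AllPairs.map (λ {X} {X′} X≢X′ {_} (t∈X , t∈X′) → X≢X′ (pattern-determined X X′ t∈X t∈X′))
                                    (power-unique (true ∷ false ∷ []) m (((λ ()) ∷ []) ∷ [] ∷ [])))

    pieces-partition : IsPartition (ΛG G m) piece pieces
    pieces-partition = record { unique = piece-unique ; disjoint = pieces-disjoint ; covers = classify ; ⊆whole = piece⊆ΛG }

    private
      dEntry≡0 : ∀ {x y : Tuple m} → ¬ dEntry x y ≢ 0ℚ → dEntry x y ≡ 0ℚ
      dEntry≡0 {x} {y} = decidable-stable (dEntry x y ℚ.≟ 0ℚ)

      no-face-in-ΛU : ∀ X → NoFaceAmong (ΛU G K m) (ΛX G K m X)
      no-face-in-ΛU X x y x∈ y∈ = dEntry≡0 {x} {y} λ dEntry≢0 →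
        proj₂ (∈U⁻ (proj₂ (∈ΛU⁻ y∈))) (K-closed (proj₂ (∈ΛX⁻ X x∈)) (⋂-mono y x (dEntry≢0⇒⊆ x y dEntry≢0)) (G-nonempty (proj₁ (∈U⁻ (proj₂ (∈ΛU⁻ y∈))))))

      -- A face of a tuple in Λ(X′) that lies in Λ(X) forces X ≼ X′, as K is closed under faces.
      no-face-in-ΛX : ∀ X X′ → ¬ X ≼ X′ → NoFaceAmong (ΛX G K m X) (ΛX G K m X′)
      no-face-in-ΛX X X′ X⋠X′ x y x∈ y∈ = dEntry≡0 {x} {y} λ dEntry≢0 → X⋠X′ (λ l Xₗ≡true → U-position dEntry≢0 l Xₗ≡true (Vec.lookup X′ l) refl)
        where
        U-position : dEntry x y ≢ 0ℚ → ∀ l → Vec.lookup X l ≡ true → ∀ b → Vec.lookup X′ l ≡ b → Vec.lookup X′ l ≡ true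
        U-position _ l _ true X′ₗ≡true = X′ₗ≡true
        U-position dEntry≢0 l Xₗ≡true false X′ₗ≡false = ⊥-elim (proj₂ (∈U⁻ yₗ∈U) (K-closed xₗ∈K (dEntry≢0⇒⊆ x y dEntry≢0 l) (G-nonempty (proj₁ (∈U⁻ yₗ∈U)))))
          where
          yₗ∈U : Vec.lookup y l ∈ U
          yₗ∈U = subst (λ b → Vec.lookup y l ∈ part b) Xₗ≡true (proj₁ (∈ΛX⁻ X y∈) l)
          xₗ∈K : Vec.lookup x l ∈ K
          xₗ∈K = subst (λ b → Vec.lookup x l ∈ part b) X′ₗ≡false (proj₁ (∈ΛX⁻ X′ x∈) l)

    pieces-noFace : AllPairs (λ i j → NoFaceAmong (piece i) (piece j)) pieces
    pieces-noFace =
      Allₚ.map⁺ (All.tabulate (λ {X} _ → no-face-in-ΛU X)) ∷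
      AllPairsₚ.map⁺ (AllPairs.map (λ {X} {X′} → no-face-in-ΛX X X′) (power-antitone m))

open import Defs
open import Data.Nat using (ℕ; suc; _+_; _≤_)
open import Data.Bool using (Bool; true; false)
open import Data.List using (List; []; _∷_; map)
open import Data.Vec using (Vec)
open import Data.Nat.Properties using (≤-trans; +-monoˡ-≤; m≤m+n)
open import Data.List.Properties using (map-∘)
open import Data.Maybe using (just; nothing)
open import Relation.Binary.PropositionalEquality using (cong; sym; subst)
open HarmonicBetti using (betti-subadditive)
open Decomposition using (module Pieces)

mainTheorem5 : (G K : List Simplex) → IsComplex G → IsSubcomplex K G →
    (m : ℕ) → 1 ≤ m →
    (k bG bU bK : ℕ) (bX : Vec Bool m → ℕ) →
    IsBetti (ΛG G m) k bG →
    IsBetti (ΛU G K m) k bU →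
    IsBetti (ΛK K m) k bK →
    ((X : Vec Bool m) → IsBetti (ΛX G K m X) k (bX X)) →
    bG ≤ bU + bK + sumℕ (map bX (power (true ∷ false ∷ []) m))
mainTheorem5 G K G-complex K-subcomplex m _ k bG bU bK bX bettiG bettiU _ bettiX =
  ≤-trans (subst (bG ≤_) (cong (λ bs → bU + sumℕ bs) (sym (map-∘ {g = b} {f = just} patterns)))
                 (betti-subadditive ΛG-unique ΛG-nonempty ΛG-faceClosed pieces-partition pieces-noFace k b bettiG bettiPiece))
          (+-monoˡ-≤ _ (m≤m+n bU bK))
  where
  open Pieces G K G-complex K-subcomplex m
  b : Piece → ℕ
  b nothing = bU
  b (just X) = bX X
  bettiPiece : ∀ i → IsBetti (piece i) k (b i)
  bettiPiece nothing = bettiU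
  bettiPiece (just X) = bettiX X
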